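{- For every $n\ge 3$, the expected number of swaps performed in the first partitioning step of Algorithm Y (Yaroslavskiy's dual-pivot Quicksort) on an array $A[1..n]$ containing a uniformly random permutation of $\{1,\dots,n\}$ equals $\tfrac{1}{2}(n+1)+\tfrac{7}{6}$.
   Context: Algorithm Y is the recursive procedure $Y(A,\mathit{left},\mathit{right})$ on an array $A$: If $\mathit{right}-\mathit{left}\ge 1$: if $A[\mathit{left}]>A[\mathit{right}]$, swap $A[\mathit{left}]$ and $A[\mathit{right}]$; set $p\gets A[\mathit{left}]$, $q\gets A[\mathit{right}]$. Set $\ell\gets\mathit{left}+1$, $g\gets\mathit{right}-1$, $k\gets\ell$. While $k\le g$: { if $A[k]<p$ then swap $A[k]$ and $A[\ell]$, $\ell\gets\ell+1$; else { if $A[k]>q$ then { while ($A[g]>q$ and $k<g$) do $g\gets g-1$; swap $A[k]$ and $A[g]$; $g\gets g-1$; if $A[k]<p$ then swap $A[k]$ and $A[\ell]$, $\ell\gets\ell+1$ } }; $k\gets k+1$ }. Then $\ell\gets\ell-1$, $g\gets g+1$; swap $A[\mathit{left}]$ and $A[\ell]$; swap $A[\mathit{right}]$ and $A[g]$; call $Y(A,\mathit{left},\ell-1)$, $Y(A,\ell+1,g-1)$, $Y(A,g+1,\mathit{right})$. The first partitioning step is the execution of the top-level call $Y(A,1,n)$ excluding the three recursive calls. The number of swaps is the number of executed "swap" operations (including the conditional initial swap of the pivot positions and the two final pivot-placing swaps). -}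

module Defs where

open import Data.Nat using (ℕ; zero; suc; _+_; _∸_; _<ᵇ_; _≤ᵇ_; _≡ᵇ_; _!)
open import Data.Nat.Properties using (_!≢0)
open import Data.Bool using (Bool; true; false; if_then_else_; _∧_)
open import Data.List using (List; []; _∷_; map; concatMap)
open import Data.Nat.ListAction using (sum)
open import Data.Integer using (+_)
open import Data.Rational using (ℚ; _/_)

-- Uniformly random permutations: the list of all n! permutations of
-- {1,…,n} (each exactly once), as lists [A[1],…,A[n]].

insertions : ℕ → List ℕ → List (List ℕ)
insertions x []       = (x ∷ []) ∷ []
insertions x (y ∷ ys) = (x ∷ y ∷ ys) ∷ map (y ∷_) (insertions x ys)

permutations : ℕ → List (List ℕ)
permutations zero    = [] ∷ []
permutations (suc n) = concatMap (insertions (suc n)) (permutations n)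

-- Arrays, 1-based: A i = A[i]  (positions outside 1..n are never read)

Array : Set
Array = ℕ → ℕ

-- nth element (0-based) of a list, default 0
nth : List ℕ → ℕ → ℕ
nth []       _       = 0
nth (x ∷ xs) zero    = x
nth (x ∷ xs) (suc i) = nth xs i

fromList : List ℕ → Array
fromList xs i = nth xs (i ∸ 1)

swap : Array → ℕ → ℕ → Array
swap A i j x = if x ≡ᵇ i then A j else (if x ≡ᵇ j then A i else A x)

record St : Set where
  constructor st
  field
    arr : Array
    ℓ   : ℕ
    g   : ℕ
    k   : ℕ
    cnt : ℕ

-- "while (A[g] > q and k < g) do g ← g - 1"; fuel g suffices since g
-- strictly decreases and stays > k ≥ 0.
innerWhile : (fuel : ℕ) → (q : ℕ) → Array → (k g : ℕ) → ℕ
innerWhile zero    q A k g = g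
innerWhile (suc f) q A k g =
  if (q <ᵇ A g) ∧ (k <ᵇ g) then innerWhile f q A k (g ∸ 1) else g

step : (p q : ℕ) → St → St
step p q (st A l g k c) =
  if A k <ᵇ p
    then st (swap A k l) (suc l) g (suc k) (suc c)
    else (if q <ᵇ A k
      then afterBig (innerWhile g q A k g)
      else st A l g (suc k) c)
  where
    afterBig : ℕ → St
    afterBig g' =
      let A'  = swap A k g'
          g'' = g' ∸ 1
      in if A' k <ᵇ p
           then st (swap A' k l) (suc l) g'' (suc k) (suc (suc c))
           else st A' l g'' (suc k) (suc c)

-- "while k ≤ g do …"; each iteration increases k by one, so fuel n
-- (the array length) is more than enough.
loop : (fuel : ℕ) → (p q : ℕ) → St → St
loop zero    p q s = s
loop (suc f) p q s with St.k s ≤ᵇ St.g s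
... | true  = loop f p q (step p q s)
... | false = s

-- Number of swaps executed by the first partitioning step, i.e. the
-- top-level call Y(A,1,n) without its recursive calls.
firstStepSwapsFrom : ℕ → Array → ℕ
firstStepSwapsFrom n A0 =
  if 1 ≤ᵇ (n ∸ 1)   -- right - left ≥ 1 with left = 1, right = n
    then body (if A0 n <ᵇ A0 1 then 1 else 0)
              (if A0 n <ᵇ A0 1 then swap A0 1 n else A0)
    else 0
  where
    body : ℕ → Array → ℕ
    body c0 A =
      let p = A 1
          q = A n
          s = loop n p q (st A 2 (n ∸ 1) 2 c0)
      in St.cnt s + 2   -- the two final pivot-placing swaps

firstStepSwaps : ℕ → List ℕ → ℕ
firstStepSwaps n xs = firstStepSwapsFrom n (fromList xs)

expectedSwaps : ℕ → ℚ
expectedSwaps n =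
  _/_ (+ sum (map (firstStepSwaps n) (permutations n))) (n !) {{n !≢0}}

-- 1. Loop analysis (any array, n = m + 3).  With pivots p = min(A[1], A[n])
--    and q = max(A[1], A[n]), a loop invariant shows that the step performs
--    2 + [A[n] < A[1]] + #{small middle entries}
--      + #{large entries among the first 1 + #{non-large middle entries} middle positions}
--    swaps (firstStepSwaps-formula).
-- 2. Counting permutations (matching-count): k constraints "position i holds v"
--    with distinct positions and values are met by (n - k)! permutations, by
--    induction along the insertion of n into the permutations of 1 .. n - 1.
-- 3. For a permutation with A[1] = x and A[n] = y there are min(x, y) - 1 small
--    and max(x, y) - 2 non-large middle entries, so its swap count is a sum of
--    terms depending on two or three entries (Ends.swaps).  By 2, summing such
--    terms over all permutations gives sums over values weighted by (n - 2)!
--    or (n - 3)! (sum-pair, sum-triple).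
-- 4. Closed forms of these value sums, via Σ M² and Σ M² (n - 1 - M), give
--    6 · (total swap count) = n! (3n + 10), which is the stated mean.
module Submission where

open import Defs
open import Data.Nat using (ℕ; zero; suc; _+_; _*_; _∸_; _≤_; _<_; _≥_; _<ᵇ_; _≤ᵇ_; _≡ᵇ_; _⊓_; _⊔_; z≤n; s≤s; s≤s⁻¹; s<s⁻¹; _!; pred; NonZero)
open import Data.Nat.Properties
open import Data.Nat.ListAction using (sum)
open import Data.Nat.Tactic.RingSolver using (solve-∀)
open import Data.Bool using (Bool; true; false; T; if_then_else_; _∧_; not)
open import Data.Unit using (⊤; tt)
open import Data.Empty using (⊥-elim)
open import Data.Product using (_×_; _,_; proj₁; proj₂)
open import Data.Sum using (_⊎_; inj₁; inj₂)
open import Data.List using (List; []; _∷_; map; concatMap; length; _++_)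
open import Data.List.Properties using (length-map)
open import Data.List.Relation.Unary.All as All using (All; []; _∷_)
open import Data.List.Relation.Unary.All.Properties using (concat⁺; map⁺)
open import Data.Integer as ℤ using (+_)
import Data.Integer.Properties as ℤ
open import Data.Rational using (_/_; toℚᵘ) renaming (_+_ to _+ℚ_)
import Data.Rational.Properties as ℚ
open import Data.Rational.Unnormalised as ℚᵘ using (mkℚᵘ; *≡*)
import Data.Rational.Unnormalised.Properties as ℚᵘ
open import Relation.Nullary using (yes; no)
open import Relation.Binary.Definitions using (tri<; tri≈; tri>)
open import Relation.Binary.PropositionalEquality

𝟙 : Bool → ℕ
𝟙 true  = 1
𝟙 false = 0

T⇒≡true : ∀ {b} → T b → b ≡ true
T⇒≡true {true} _ = refl

<ᵇ⇒<′ : ∀ {x y} → (x <ᵇ y) ≡ true → x < y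
<ᵇ⇒<′ {x} {y} e = <ᵇ⇒< x y (subst T (sym e) tt)

¬<ᵇ⇒≥ : ∀ {x y} → (x <ᵇ y) ≡ false → y ≤ x
¬<ᵇ⇒≥ e = ≮⇒≥ (λ x<y → subst T e (<⇒<ᵇ x<y))

<⇒<ᵇ′ : ∀ {x y} → x < y → (x <ᵇ y) ≡ true
<⇒<ᵇ′ x<y = T⇒≡true (<⇒<ᵇ x<y)

≥⇒¬<ᵇ : ∀ {x y} → y ≤ x → (x <ᵇ y) ≡ false
≥⇒¬<ᵇ {x} {y} y≤x with x <ᵇ y in e
... | false = refl
... | true  = ⊥-elim (<⇒≱ (<ᵇ⇒<′ e) y≤x)

≤ᵇ⇒≤′ : ∀ {x y} → (x ≤ᵇ y) ≡ true → x ≤ y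
≤ᵇ⇒≤′ {x} {y} e = ≤ᵇ⇒≤ x y (subst T (sym e) tt)

¬≤ᵇ⇒> : ∀ {x y} → (x ≤ᵇ y) ≡ false → y < x
¬≤ᵇ⇒> e = ≰⇒> (λ x≤y → subst T e (≤⇒≤ᵇ x≤y))

≤⇒≤ᵇ′ : ∀ {x y} → x ≤ y → (x ≤ᵇ y) ≡ true
≤⇒≤ᵇ′ x≤y = T⇒≡true (≤⇒≤ᵇ x≤y)

>⇒¬≤ᵇ : ∀ {x y} → y < x → (x ≤ᵇ y) ≡ false
>⇒¬≤ᵇ {x} {y} y<x with x ≤ᵇ y in e
... | false = refl
... | true  = ⊥-elim (<⇒≱ y<x (≤ᵇ⇒≤′ e))

≡ᵇ⇒≡′ : ∀ {x y} → (x ≡ᵇ y) ≡ true → x ≡ y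
≡ᵇ⇒≡′ {x} {y} e = ≡ᵇ⇒≡ x y (subst T (sym e) tt)

≡ᵇ-refl : ∀ x → (x ≡ᵇ x) ≡ true
≡ᵇ-refl x = T⇒≡true (≡⇒≡ᵇ x x refl)

¬≡ᵇ⇒≢ : ∀ {x y} → (x ≡ᵇ y) ≡ false → x ≢ y
¬≡ᵇ⇒≢ {x} e refl rewrite ≡ᵇ-refl x = case e
  where
  case : true ≢ false
  case ()

≢⇒¬≡ᵇ : ∀ {x y} → x ≢ y → (x ≡ᵇ y) ≡ false
≢⇒¬≡ᵇ {x} {y} x≢y with x ≡ᵇ y in e
... | false = refl
... | true  = ⊥-elim (x≢y (≡ᵇ⇒≡′ e))

Σ< : ℕ → (ℕ → ℕ) → ℕ
Σ< zero    f = 0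
Σ< (suc n) f = Σ< n f + f n

Σ<-cong : ∀ n {f g} → (∀ i → i < n → f i ≡ g i) → Σ< n f ≡ Σ< n g
Σ<-cong zero    f≗g = refl
Σ<-cong (suc n) f≗g = cong₂ _+_ (Σ<-cong n (λ i i<n → f≗g i (m<n⇒m<1+n i<n))) (f≗g n ≤-refl)

Σ<-+ : ∀ n f g → Σ< n (λ i → f i + g i) ≡ Σ< n f + Σ< n g
Σ<-+ zero    f g = refl
Σ<-+ (suc n) f g rewrite Σ<-+ n f g = shuffle (Σ< n f) (Σ< n g) (f n) (g n)
  where
  shuffle : ∀ a b c d → a + b + (c + d) ≡ a + c + (b + d)
  shuffle = solve-∀

Σ<-*ˡ : ∀ n c f → Σ< n (λ i → c * f i) ≡ c * Σ< n f
Σ<-*ˡ zero    c f = sym (*-zeroʳ c)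
Σ<-*ˡ (suc n) c f rewrite Σ<-*ˡ n c f = sym (*-distribˡ-+ c (Σ< n f) (f n))

Σ<-*ʳ : ∀ n f c → Σ< n (λ i → f i * c) ≡ Σ< n f * c
Σ<-*ʳ n f c = trans (Σ<-cong n (λ i _ → *-comm (f i) c)) (trans (Σ<-*ˡ n c f) (*-comm c (Σ< n f)))

Σ<-const : ∀ n c → Σ< n (λ _ → c) ≡ n * c
Σ<-const zero    c = refl
Σ<-const (suc n) c rewrite Σ<-const n c = +-comm (n * c) c

Σ<-zero : ∀ n → Σ< n (λ _ → 0) ≡ 0
Σ<-zero n = trans (Σ<-const n 0) (*-zeroʳ n)

Σ<-head : ∀ n f → Σ< (suc n) f ≡ f 0 + Σ< n (λ i → f (suc i))
Σ<-head zero    f = sym (+-identityʳ _)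
Σ<-head (suc n) f rewrite Σ<-head n f = +-assoc (f 0) _ (f (suc n))

Σ<-split : ∀ a b f → Σ< (a + b) f ≡ Σ< a f + Σ< b (λ i → f (a + i))
Σ<-split a zero    f rewrite +-identityʳ a = sym (+-identityʳ _)
Σ<-split a (suc b) f rewrite +-suc a b | Σ<-split a b f = +-assoc (Σ< a f) _ (f (a + b))

Σ<-swap : ∀ m n (f : ℕ → ℕ → ℕ) → Σ< m (λ i → Σ< n (f i)) ≡ Σ< n (λ j → Σ< m (λ i → f i j))
Σ<-swap zero    n f = sym (Σ<-zero n)
Σ<-swap (suc m) n f rewrite Σ<-swap m n f = sym (Σ<-+ n (λ j → Σ< m (λ i → f i j)) (f m))

Σ<-vanishing : ∀ a b f → a ≤ b → (∀ i → a ≤ i → i < b → f i ≡ 0) → Σ< b f ≡ Σ< a f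
Σ<-vanishing a b f a≤b vanish with m≤n⇒∃[o]m+o≡n a≤b
... | d , refl = begin
  Σ< (a + d) f                           ≡⟨ Σ<-split a d f ⟩
  Σ< a f + Σ< d (λ i → f (a + i))        ≡⟨ cong (_+_ (Σ< a f)) tail≡0 ⟩
  Σ< a f + 0                             ≡⟨ +-identityʳ _ ⟩
  Σ< a f                                 ∎
  where
  open ≡-Reasoning
  tail≡0 : Σ< d (λ i → f (a + i)) ≡ 0
  tail≡0 = trans (Σ<-cong d (λ i i<d → vanish (a + i) (m≤m+n a i) (+-monoʳ-< a i<d))) (Σ<-zero d)

Σ<-δ-out : ∀ m i (g : ℕ → ℕ) → m ≤ i → Σ< m (λ t → 𝟙 (i ≡ᵇ t) * g t) ≡ 0
Σ<-δ-out zero    i g _   = refl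
Σ<-δ-out (suc m) i g m<i
  rewrite Σ<-δ-out m i g (≤-trans (n≤1+n m) m<i) | ≢⇒¬≡ᵇ {i} {m} (λ i≡m → <-irrefl (sym i≡m) m<i) = refl

Σ<-δ : ∀ m i (g : ℕ → ℕ) → i < m → Σ< m (λ t → 𝟙 (i ≡ᵇ t) * g t) ≡ g i
Σ<-δ (suc m) i g i<1+m with m≤n⇒m<n∨m≡n (s≤s⁻¹ i<1+m)
... | inj₁ i<m rewrite Σ<-δ m i g i<m | ≢⇒¬≡ᵇ {i} {m} (<⇒≢ i<m) = +-identityʳ (g i)
... | inj₂ refl rewrite Σ<-δ-out i i g ≤-refl | ≡ᵇ-refl i = +-identityʳ (g i)

Σ<-cutoff-all : ∀ m w f → m ≤ suc w → Σ< m (λ i → 𝟙 (i ≤ᵇ w) * f i) ≡ Σ< m f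
Σ<-cutoff-all zero    w f _ = refl
Σ<-cutoff-all (suc m) w f m<1+w
  rewrite ≤⇒≤ᵇ′ {m} {w} (s≤s⁻¹ m<1+w) | Σ<-cutoff-all m w f (m≤n⇒m≤1+n (s≤s⁻¹ m<1+w)) =
  cong (_+_ (Σ< m f)) (+-identityʳ (f m))

Σ<-cutoff : ∀ m w f → w < m → Σ< m (λ i → 𝟙 (i ≤ᵇ w) * f i) ≡ Σ< (suc w) f
Σ<-cutoff (suc m) w f w<1+m with m≤n⇒m<n∨m≡n (s≤s⁻¹ w<1+m)
... | inj₁ w<m rewrite >⇒¬≤ᵇ {m} {w} w<m | Σ<-cutoff m w f w<m = +-identityʳ _
... | inj₂ refl rewrite ≤⇒≤ᵇ′ {m} {m} ≤-refl | Σ<-cutoff-all m m f (n≤1+n m) =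
  cong (_+_ (Σ< m f)) (+-identityʳ (f m))

ΣL : {A : Set} → List A → (A → ℕ) → ℕ
ΣL []       f = 0
ΣL (x ∷ xs) f = f x + ΣL xs f

module _ {A : Set} where

  sum-map≡ΣL : ∀ (xs : List A) f → sum (map f xs) ≡ ΣL xs f
  sum-map≡ΣL []       f = refl
  sum-map≡ΣL (x ∷ xs) f = cong (_+_ (f x)) (sum-map≡ΣL xs f)

  ΣL-++ : ∀ (xs ys : List A) f → ΣL (xs ++ ys) f ≡ ΣL xs f + ΣL ys f
  ΣL-++ []       ys f = refl
  ΣL-++ (x ∷ xs) ys f rewrite ΣL-++ xs ys f = sym (+-assoc (f x) _ _)

  ΣL-congᴬ : ∀ (xs : List A) {f g} → All (λ x → f x ≡ g x) xs → ΣL xs f ≡ ΣL xs g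
  ΣL-congᴬ []       []         = refl
  ΣL-congᴬ (x ∷ xs) (fx≡gx ∷ h) = cong₂ _+_ fx≡gx (ΣL-congᴬ xs h)

  ΣL-cong : ∀ (xs : List A) {f g} → (∀ x → f x ≡ g x) → ΣL xs f ≡ ΣL xs g
  ΣL-cong []       f≗g = refl
  ΣL-cong (x ∷ xs) f≗g = cong₂ _+_ (f≗g x) (ΣL-cong xs f≗g)

  ΣL-+ : ∀ (xs : List A) f g → ΣL xs (λ x → f x + g x) ≡ ΣL xs f + ΣL xs g
  ΣL-+ []       f g = refl
  ΣL-+ (x ∷ xs) f g rewrite ΣL-+ xs f g = shuffle (f x) (g x) (ΣL xs f) (ΣL xs g)
    where
    shuffle : ∀ a b c d → a + b + (c + d) ≡ a + c + (b + d)
    shuffle = solve-∀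

  ΣL-*ˡ : ∀ (xs : List A) c f → ΣL xs (λ x → c * f x) ≡ c * ΣL xs f
  ΣL-*ˡ []       c f = sym (*-zeroʳ c)
  ΣL-*ˡ (x ∷ xs) c f rewrite ΣL-*ˡ xs c f = sym (*-distribˡ-+ c (f x) _)

  ΣL-*ʳ : ∀ (xs : List A) f c → ΣL xs (λ x → f x * c) ≡ ΣL xs f * c
  ΣL-*ʳ xs f c = trans (ΣL-cong xs (λ x → *-comm (f x) c)) (trans (ΣL-*ˡ xs c f) (*-comm c (ΣL xs f)))

  ΣL-vanishing : ∀ (xs : List A) f → All (λ x → f x ≡ 0) xs → ΣL xs f ≡ 0
  ΣL-vanishing []       f []           = refl
  ΣL-vanishing (x ∷ xs) f (fx≡0 ∷ h) rewrite fx≡0 = ΣL-vanishing xs f h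

  ΣL-Σ< : ∀ (xs : List A) n (f : A → ℕ → ℕ) → ΣL xs (λ x → Σ< n (f x)) ≡ Σ< n (λ t → ΣL xs (λ x → f x t))
  ΣL-Σ< []       n f = sym (Σ<-zero n)
  ΣL-Σ< (x ∷ xs) n f rewrite ΣL-Σ< xs n f = sym (Σ<-+ n (f x) (λ t → ΣL xs (λ x → f x t)))

ΣL-map : ∀ {A B : Set} (xs : List A) (g : A → B) f → ΣL (map g xs) f ≡ ΣL xs (λ x → f (g x))
ΣL-map []       g f = refl
ΣL-map (x ∷ xs) g f = cong (_+_ (f (g x))) (ΣL-map xs g f)

ΣL-concatMap : ∀ {A B : Set} (xs : List A) (g : A → List B) f → ΣL (concatMap g xs) f ≡ ΣL xs (λ x → ΣL (g x) f)
ΣL-concatMap []       g f = refl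
ΣL-concatMap (x ∷ xs) g f rewrite ΣL-++ (g x) (concatMap g xs) f | ΣL-concatMap xs g f = refl

swap-at-j : ∀ A i j → swap A i j j ≡ A i
swap-at-j A i j with j ≡ᵇ i in e
... | true  = cong A (≡ᵇ⇒≡′ e)
... | false rewrite ≡ᵇ-refl j = refl

swap-elsewhere : ∀ A i j x → x ≢ i → x ≢ j → swap A i j x ≡ A x
swap-elsewhere A i j x x≢i x≢j rewrite ≢⇒¬≡ᵇ x≢i | ≢⇒¬≡ᵇ x≢j = refl

record InnerStop (q : ℕ) (A : Array) (k g g' : ℕ) : Set where
  field
    k≤g'       : k ≤ g'
    g'≤g       : g' ≤ g
    largeAbove : ∀ i → g' < i → i ≤ g → (q <ᵇ A i) ≡ true
    stopped    : g' ≡ k ⊎ (q <ᵇ A g') ≡ false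

stopHere : ∀ {q A k g} → k ≤ g → g ≡ k ⊎ (q <ᵇ A g) ≡ false → InnerStop q A k g g
stopHere k≤g why = record
  { k≤g' = k≤g ; g'≤g = ≤-refl ; largeAbove = λ i g<i i≤g → ⊥-elim (<⇒≱ g<i i≤g) ; stopped = why }

stopBelow : ∀ {q A k g g'} → InnerStop q A k g g' → (q <ᵇ A (suc g)) ≡ true → InnerStop q A k (suc g) g'
stopBelow {q} {A} {k} {g} {g'} s large = record
  { k≤g' = k≤g' ; g'≤g = m≤n⇒m≤1+n g'≤g ; largeAbove = above ; stopped = stopped }
  where
  open InnerStop s
  above : ∀ i → g' < i → i ≤ suc g → (q <ᵇ A i) ≡ true
  above i g'<i i≤1+g with m≤n⇒m<n∨m≡n i≤1+g
  ... | inj₁ i≤g = largeAbove i g'<i (s≤s⁻¹ i≤g)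
  ... | inj₂ refl = large

innerWhile-stops : ∀ q fuel A k g → k ≤ g → g ≤ fuel + k → InnerStop q A k g (innerWhile fuel q A k g)
innerWhile-stops q zero A k g k≤g g≤k with ≤-antisym k≤g g≤k
... | refl = stopHere ≤-refl (inj₁ refl)
innerWhile-stops q (suc fuel) A k zero k≤0 _ with q <ᵇ A zero
... | false = stopHere k≤0 (inj₁ (sym (n≤0⇒n≡0 k≤0)))
... | true  = stopHere k≤0 (inj₁ (sym (n≤0⇒n≡0 k≤0)))
innerWhile-stops q (suc fuel) A k (suc g) k≤g g≤ with q <ᵇ A (suc g) in large | k <ᵇ suc g in k<g
... | false | _     = stopHere k≤g (inj₂ large)
... | true  | false = stopHere k≤g (inj₁ (≤-antisym (¬<ᵇ⇒≥ k<g) k≤g))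
... | true  | true  =
  stopBelow (innerWhile-stops q fuel A k g (s≤s⁻¹ (<ᵇ⇒<′ k<g)) (s≤s⁻¹ g≤)) large

-- The state reached by a step that met a large A[k], once the inner loop
-- stopped at g' (this is the local continuation inside `step`).
afterLarge : (p : ℕ) → Array → (l k c g' : ℕ) → St
afterLarge p A l k c g' =
  if swap A k g' k <ᵇ p
    then st (swap (swap A k g') k l) (suc l) (g' ∸ 1) (suc k) (suc (suc c))
    else st (swap A k g') l (g' ∸ 1) (suc k) (suc c)

module StepCases (p q : ℕ) (A : Array) (l g k c : ℕ) where

  step-small : (A k <ᵇ p) ≡ true → step p q (st A l g k c) ≡ st (swap A k l) (suc l) g (suc k) (suc c)
  step-small e rewrite e = refl

  step-medium : (A k <ᵇ p) ≡ false → (q <ᵇ A k) ≡ false → step p q (st A l g k c) ≡ st A l g (suc k) c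
  step-medium e₁ e₂ rewrite e₁ | e₂ = refl

  step-large : (A k <ᵇ p) ≡ false → (q <ᵇ A k) ≡ true →
               step p q (st A l g k c) ≡ afterLarge p A l k c (innerWhile g q A k g)
  step-large e₁ e₂ rewrite e₁ | e₂ = refl

  afterLarge-small : ∀ g' → (A g' <ᵇ p) ≡ true →
    afterLarge p A l k c g' ≡ st (swap (swap A k g') k l) (suc l) (g' ∸ 1) (suc k) (suc (suc c))
  afterLarge-small g' e rewrite ≡ᵇ-refl k | e = refl

  afterLarge-notSmall : ∀ g' → (A g' <ᵇ p) ≡ false →
    afterLarge p A l k c g' ≡ st (swap A k g') l (g' ∸ 1) (suc k) (suc c)
  afterLarge-notSmall g' e rewrite ≡ᵇ-refl k | e = refl

loop-exit : ∀ p q f A l g k c → (k ≤ᵇ g) ≡ false → loop f p q (st A l g k c) ≡ st A l g k c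
loop-exit p q zero    A l g k c e = refl
loop-exit p q (suc f) A l g k c e rewrite e = refl

middleNonLarge : ℕ → Array → ℕ → ℕ
middleNonLarge m A q = Σ< (suc m) (λ j → 𝟙 (not (q <ᵇ A (2 + j))))

module LoopAnalysis (A0 : Array) (p q m c0 : ℕ) (p≤q : p ≤ q) where

  R : ℕ
  R = 2 + m

  small large notLarge : ℕ → ℕ
  small    i = 𝟙 (A0 i <ᵇ p)
  large    i = 𝟙 (q <ᵇ A0 i)
  notLarge i = 𝟙 (not (q <ᵇ A0 i))

  smalls larges nonLarges : ℕ → ℕ
  smalls    k = Σ< k small
  larges    k = Σ< k large
  nonLarges k = Σ< k notLarge

  middleNonLarges : ℕ
  middleNonLarges = middleNonLarge m A0 q

  largesUpTo : ℕ → ℕ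
  largesUpTo w = Σ< (suc R) (λ i → 𝟙 (i ≤ᵇ w) * large i)

  nonLarges+larges : ∀ k → nonLarges k + larges k ≡ k
  nonLarges+larges k = begin
    nonLarges k + larges k             ≡⟨ Σ<-+ k notLarge large ⟨
    Σ< k (λ i → notLarge i + large i)  ≡⟨ Σ<-cong k (λ i _ → oneOf i) ⟩
    Σ< k (λ _ → 1)                     ≡⟨ Σ<-const k 1 ⟩
    k * 1                              ≡⟨ *-identityʳ k ⟩
    k                                  ∎
    where
    open ≡-Reasoning
    oneOf : ∀ i → notLarge i + large i ≡ 1
    oneOf i with q <ᵇ A0 i
    ... | true  = refl
    ... | false = refl

  large⇒¬small : ∀ i → (q <ᵇ A0 i) ≡ true → small i ≡ 0
  large⇒¬small i e = cong 𝟙 (≥⇒¬<ᵇ (≤-trans p≤q (<⇒≤ (<ᵇ⇒<′ e))))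

  large⇒¬notLarge : ∀ i → (q <ᵇ A0 i) ≡ true → notLarge i ≡ 0
  large⇒¬notLarge i e rewrite e = refl

  small⇒¬large : ∀ i → (A0 i <ᵇ p) ≡ true → (q <ᵇ A0 i) ≡ false
  small⇒¬large i e = ≥⇒¬<ᵇ (≤-trans (<⇒≤ (<ᵇ⇒<′ e)) p≤q)

  -- Loop invariant for the state (A, ℓ, g, k, c) with the given fuel.
  -- count:   c - c0 = smalls in [2, k) + smalls in (g, R] + larges in [2, k);
  -- balance: the non-large entries in (g, R] are as many as the larges in [2, k).
  record Invariant (A : Array) (l g k c fuel : ℕ) : Set where
    field
      -- the unscanned part [k, g] is as in A0, and swaps at ℓ ≤ k do not touch it
      untouched  : ∀ i → k ≤ i → i ≤ g → A i ≡ A0 i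
      l≤k        : l ≤ k
      2≤k        : 2 ≤ k
      k≤1+g      : k ≤ suc g
      g≤R        : g ≤ R
      enoughFuel : suc (suc g) ≤ fuel + k
      count      : c + smalls (suc g) + smalls 2 + larges 2 ≡ c0 + smalls k + smalls (suc R) + larges k
      balance    : nonLarges (suc R) + larges 2 ≡ nonLarges (suc g) + larges k
      boundary   : g ≡ R ⊎ (q <ᵇ A0 (suc g)) ≡ false

  -- What the loop computes: c - c0 = smalls in [2, R] + larges in [2, 2 + middleNonLarges].
  Final : ℕ → Set
  Final c = c + smalls 2 + larges 2 ≡ c0 + smalls (suc R) + largesUpTo (middleNonLarges + 2)

  frontSize : ∀ k → nonLarges (suc R) + larges 2 ≡ nonLarges k + larges k → middleNonLarges + 2 ≡ k
  frontSize k bal = begin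
    middleNonLarges + 2                              ≡⟨ cong (_+_ middleNonLarges) (nonLarges+larges 2) ⟨
    middleNonLarges + (nonLarges 2 + larges 2)       ≡⟨ +-assoc middleNonLarges (nonLarges 2) (larges 2) ⟨
    middleNonLarges + nonLarges 2 + larges 2         ≡⟨ cong (_+ larges 2) split ⟩
    nonLarges (suc R) + larges 2                     ≡⟨ bal ⟩
    nonLarges k + larges k                           ≡⟨ nonLarges+larges k ⟩
    k                                                ∎
    where
    open ≡-Reasoning
    split : middleNonLarges + nonLarges 2 ≡ nonLarges (suc R)
    split = trans (+-comm middleNonLarges (nonLarges 2)) (sym (Σ<-split 2 (suc m) notLarge))

  cancel-tail : ∀ c X a b c0 Y Z → c + X + a + b ≡ c0 + X + Y + Z → c + a + b ≡ c0 + Y + Z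
  cancel-tail c X a b c0 Y Z h = +-cancelˡ-≡ X _ _ (trans (reorder₁ c X a b) (trans h (reorder₂ c0 X Y Z)))
    where
    reorder₁ : ∀ c X a b → X + (c + a + b) ≡ c + X + a + b
    reorder₁ = solve-∀
    reorder₂ : ∀ c0 X Y Z → c0 + X + Y + Z ≡ X + (c0 + Y + Z)
    reorder₂ = solve-∀

  final-exit : ∀ {A l g k c f} → Invariant A l g k c f → k ≡ suc g → Final c
  final-exit {A} {l} {g} {.(suc g)} {c} inv refl = goal
    where
    open Invariant inv
    cutoff : largesUpTo (suc g) ≡ larges (suc g)
    cutoff with m≤n⇒m<n∨m≡n g≤R
    ... | inj₂ refl = Σ<-cutoff-all (suc g) (suc g) large (n≤1+n (suc g))
    ... | inj₁ g<R with boundary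
    ...   | inj₁ refl = ⊥-elim (<-irrefl refl g<R)
    ...   | inj₂ e rewrite Σ<-cutoff (suc R) (suc g) large (s≤s g<R) | e = +-identityʳ _
    goal : Final c
    goal rewrite frontSize (suc g) balance | cutoff =
      cancel-tail c (smalls (suc g)) (smalls 2) (larges 2) c0 (smalls (suc R)) (larges (suc g)) count

  -- The inner loop ran down to k: all of [k, g] is large, and one more swap
  -- (of A[k] with itself) is counted before the loop exits.
  final-exhausted : ∀ {A l g k c f} → Invariant A l g k c f → k ≤ g →
                    (∀ i → k ≤ i → i ≤ g → (q <ᵇ A0 i) ≡ true) → Final (suc c)
  final-exhausted {A} {l} {g} {k} {c} inv k≤g allLarge = goal
    where
    open Invariant inv
    smallsEq : smalls (suc g) ≡ smalls k
    smallsEq = Σ<-vanishing k (suc g) small (m≤n⇒m≤1+n k≤g)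
                 (λ i k≤i i<1+g → large⇒¬small i (allLarge i k≤i (s≤s⁻¹ i<1+g)))
    nonLargesEq : nonLarges (suc g) ≡ nonLarges k
    nonLargesEq = Σ<-vanishing k (suc g) notLarge (m≤n⇒m≤1+n k≤g)
                    (λ i k≤i i<1+g → large⇒¬notLarge i (allLarge i k≤i (s≤s⁻¹ i<1+g)))
    counted : c + smalls 2 + larges 2 ≡ c0 + smalls (suc R) + larges k
    counted = cancel-tail c (smalls k) (smalls 2) (larges 2) c0 (smalls (suc R)) (larges k)
                (subst (λ z → c + z + smalls 2 + larges 2 ≡ c0 + smalls k + smalls (suc R) + larges k) smallsEq count)
    cutoff : largesUpTo k ≡ larges k + 1
    cutoff rewrite Σ<-cutoff (suc R) k large (s≤s (≤-trans k≤g g≤R)) | allLarge k ≤-refl k≤g = refl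
    reorder : ∀ a b d → suc (a + b + d) ≡ a + b + (d + 1)
    reorder = solve-∀
    goal : Final (suc c)
    goal rewrite frontSize k (trans balance (cong (_+ larges k) nonLargesEq)) | cutoff =
      trans (cong suc counted) (reorder c0 (smalls (suc R)) (larges k))

  fuel-step : ∀ {g f k} → suc (suc g) ≤ suc f + k → suc (suc g) ≤ f + suc k
  fuel-step {g} {f} {k} h = subst (suc (suc g) ≤_) (sym (+-suc f k)) h

  inv-small : ∀ {A l g k c f} → Invariant A l g k c (suc f) → k ≤ g → (A0 k <ᵇ p) ≡ true →
              Invariant (swap A k l) (suc l) g (suc k) (suc c) f
  inv-small {A} {l} {g} {k} {c} {f} inv k≤g kSmall = record
    { untouched  = untouched′
    ; l≤k        = s≤s l≤k
    ; 2≤k        = ≤-trans 2≤k (n≤1+n k)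
    ; k≤1+g      = s≤s k≤g
    ; g≤R        = g≤R
    ; enoughFuel = fuel-step enoughFuel
    ; count      = count′
    ; balance    = balance′
    ; boundary   = boundary
    }
    where
    open Invariant inv
    untouched′ : ∀ i → suc k ≤ i → i ≤ g → swap A k l i ≡ A0 i
    untouched′ i k<i i≤g =
      trans (swap-elsewhere A k l i (λ i≡k → <-irrefl (sym i≡k) k<i) (λ i≡l → <-irrefl (sym i≡l) (≤-<-trans l≤k k<i)))
            (untouched i (<⇒≤ k<i) i≤g)
    arith : ∀ c X a b c0 K Y L → c + X + a + b ≡ c0 + K + Y + L → suc c + X + a + b ≡ c0 + (K + 1) + Y + (L + 0)
    arith c X a b c0 K Y L h = trans (cong suc h) (reorder c0 K Y L)
      where
      reorder : ∀ c0 K Y L → suc (c0 + K + Y + L) ≡ c0 + (K + 1) + Y + (L + 0)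
      reorder = solve-∀
    count′ : suc c + smalls (suc g) + smalls 2 + larges 2 ≡ c0 + smalls (suc k) + smalls (suc R) + larges (suc k)
    count′ rewrite kSmall | small⇒¬large k kSmall =
      arith c (smalls (suc g)) (smalls 2) (larges 2) c0 (smalls k) (smalls (suc R)) (larges k) count
    balance′ : nonLarges (suc R) + larges 2 ≡ nonLarges (suc g) + larges (suc k)
    balance′ rewrite small⇒¬large k kSmall = trans balance (cong (_+_ (nonLarges (suc g))) (sym (+-identityʳ _)))

  inv-medium : ∀ {A l g k c f} → Invariant A l g k c (suc f) → k ≤ g →
               (A0 k <ᵇ p) ≡ false → (q <ᵇ A0 k) ≡ false → Invariant A l g (suc k) c f
  inv-medium {A} {l} {g} {k} {c} {f} inv k≤g kNotSmall kNotLarge = record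
    { untouched  = λ i k<i i≤g → untouched i (<⇒≤ k<i) i≤g
    ; l≤k        = ≤-trans l≤k (n≤1+n k)
    ; 2≤k        = ≤-trans 2≤k (n≤1+n k)
    ; k≤1+g      = s≤s k≤g
    ; g≤R        = g≤R
    ; enoughFuel = fuel-step enoughFuel
    ; count      = count′
    ; balance    = balance′
    ; boundary   = boundary
    }
    where
    open Invariant inv
    arith : ∀ c X a b c0 K Y L → c + X + a + b ≡ c0 + K + Y + L → c + X + a + b ≡ c0 + (K + 0) + Y + (L + 0)
    arith c X a b c0 K Y L h = trans h (reorder c0 K Y L)
      where
      reorder : ∀ c0 K Y L → c0 + K + Y + L ≡ c0 + (K + 0) + Y + (L + 0)
      reorder = solve-∀
    count′ : c + smalls (suc g) + smalls 2 + larges 2 ≡ c0 + smalls (suc k) + smalls (suc R) + larges (suc k)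
    count′ rewrite kNotSmall | kNotLarge =
      arith c (smalls (suc g)) (smalls 2) (larges 2) c0 (smalls k) (smalls (suc R)) (larges k) count
    balance′ : nonLarges (suc R) + larges 2 ≡ nonLarges (suc g) + larges (suc k)
    balance′ rewrite kNotLarge = trans balance (cong (_+_ (nonLarges (suc g))) (sym (+-identityʳ _)))

  module SwapWithBack {A l g k c f h} (inv : Invariant A l g k c (suc f)) (k≤g : k ≤ g)
                      (kNotSmall : (A0 k <ᵇ p) ≡ false) (kLarge : (q <ᵇ A0 k) ≡ true)
                      (stop : InnerStop q A k g (suc h)) (g'≢k : suc h ≢ k) where
    open Invariant inv
    open InnerStop stop

    k<g' : k < suc h
    k<g' = ≤∧≢⇒< k≤g' (λ k≡g' → g'≢k (sym k≡g'))

    A-g' : A (suc h) ≡ A0 (suc h)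
    A-g' = untouched (suc h) (<⇒≤ k<g') g'≤g

    g'NotLarge : (q <ᵇ A0 (suc h)) ≡ false
    g'NotLarge with stopped
    ... | inj₁ g'≡k = ⊥-elim (g'≢k g'≡k)
    ... | inj₂ e    = trans (cong (q <ᵇ_) (sym A-g')) e

    largeAbove₀ : ∀ i → suc h < i → i ≤ g → (q <ᵇ A0 i) ≡ true
    largeAbove₀ i g'<i i≤g = trans (cong (q <ᵇ_) (sym (untouched i (≤-trans (<⇒≤ k<g') (<⇒≤ g'<i)) i≤g))) (largeAbove i g'<i i≤g)

    aboveVanishes : ∀ (F : ℕ → ℕ) → (∀ i → (q <ᵇ A0 i) ≡ true → F i ≡ 0) → Σ< (suc g) F ≡ Σ< (suc (suc h)) F
    aboveVanishes F vanish = Σ<-vanishing (suc (suc h)) (suc g) F (s≤s g'≤g)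
                               (λ i g'<i i<1+g → vanish i (largeAbove₀ i g'<i (s≤s⁻¹ i<1+g)))

    untouched₁ : ∀ i → suc k ≤ i → i ≤ h → swap A k (suc h) i ≡ A0 i
    untouched₁ i k<i i≤h =
      trans (swap-elsewhere A k (suc h) i (λ i≡k → <-irrefl (sym i≡k) k<i) (λ i≡g' → <-irrefl i≡g' (s≤s i≤h)))
            (untouched i (<⇒≤ k<i) (≤-trans i≤h (≤-trans (n≤1+n h) g'≤g)))

    fuel₁ : suc (suc h) ≤ f + suc k
    fuel₁ = ≤-trans (s≤s g'≤g) (≤-trans (s≤s⁻¹ enoughFuel) (+-monoʳ-≤ f (n≤1+n k)))

    count₀ : c + (smalls (suc h) + small (suc h)) + smalls 2 + larges 2 ≡ c0 + smalls k + smalls (suc R) + larges k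
    count₀ = subst (λ z → c + z + smalls 2 + larges 2 ≡ c0 + smalls k + smalls (suc R) + larges k)
                   (aboveVanishes small large⇒¬small) count

    balance₁ : nonLarges (suc R) + larges 2 ≡ nonLarges (suc h) + larges (suc k)
    balance₁ rewrite kLarge = begin
      nonLarges (suc R) + larges 2                        ≡⟨ balance ⟩
      nonLarges (suc g) + larges k                        ≡⟨ cong (_+ larges k) (aboveVanishes notLarge large⇒¬notLarge) ⟩
      nonLarges (suc h) + notLarge (suc h) + larges k     ≡⟨ cong (λ z → nonLarges (suc h) + 𝟙 (not z) + larges k) g'NotLarge ⟩
      nonLarges (suc h) + 1 + larges k                    ≡⟨ reorder (nonLarges (suc h)) (larges k) ⟩
      nonLarges (suc h) + (larges k + 1)                  ∎
      where
      open ≡-Reasoning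
      reorder : ∀ a b → a + 1 + b ≡ a + (b + 1)
      reorder = solve-∀

    inv-swapSmall : (A0 (suc h) <ᵇ p) ≡ true → Invariant (swap (swap A k (suc h)) k l) (suc l) h (suc k) (suc (suc c)) f
    inv-swapSmall g'Small = record
      { untouched  = λ i k<i i≤h →
          trans (swap-elsewhere (swap A k (suc h)) k l i (λ i≡k → <-irrefl (sym i≡k) k<i) (λ i≡l → <-irrefl (sym i≡l) (≤-<-trans l≤k k<i)))
                (untouched₁ i k<i i≤h)
      ; l≤k        = s≤s l≤k
      ; 2≤k        = ≤-trans 2≤k (n≤1+n k)
      ; k≤1+g      = k<g'
      ; g≤R        = ≤-trans (n≤1+n h) (≤-trans g'≤g g≤R)
      ; enoughFuel = fuel₁
      ; count      = count′
      ; balance    = balance₁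
      ; boundary   = inj₂ g'NotLarge
      }
      where
      arith : ∀ c X a b c0 K Y L → c + (X + 1) + a + b ≡ c0 + K + Y + L → suc (suc c) + X + a + b ≡ c0 + (K + 0) + Y + (L + 1)
      arith c X a b c0 K Y L h = trans (reorder₁ c X a b) (trans (cong suc h) (reorder₂ c0 K Y L))
        where
        reorder₁ : ∀ c X a b → suc (suc c) + X + a + b ≡ suc (c + (X + 1) + a + b)
        reorder₁ = solve-∀
        reorder₂ : ∀ c0 K Y L → suc (c0 + K + Y + L) ≡ c0 + (K + 0) + Y + (L + 1)
        reorder₂ = solve-∀
      count′ : suc (suc c) + smalls (suc h) + smalls 2 + larges 2 ≡ c0 + smalls (suc k) + smalls (suc R) + larges (suc k)
      count′ rewrite kNotSmall | kLarge = arith c (smalls (suc h)) (smalls 2) (larges 2) c0 (smalls k) (smalls (suc R)) (larges k)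
          (subst (λ z → c + (smalls (suc h) + 𝟙 z) + smalls 2 + larges 2 ≡ c0 + smalls k + smalls (suc R) + larges k) g'Small count₀)

    inv-swapMedium : (A0 (suc h) <ᵇ p) ≡ false → Invariant (swap A k (suc h)) l h (suc k) (suc c) f
    inv-swapMedium g'NotSmall = record
      { untouched  = untouched₁
      ; l≤k        = ≤-trans l≤k (n≤1+n k)
      ; 2≤k        = ≤-trans 2≤k (n≤1+n k)
      ; k≤1+g      = k<g'
      ; g≤R        = ≤-trans (n≤1+n h) (≤-trans g'≤g g≤R)
      ; enoughFuel = fuel₁
      ; count      = count′
      ; balance    = balance₁
      ; boundary   = inj₂ g'NotLarge
      }
      where
      arith : ∀ c X a b c0 K Y L → c + (X + 0) + a + b ≡ c0 + K + Y + L → suc c + X + a + b ≡ c0 + (K + 0) + Y + (L + 1)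
      arith c X a b c0 K Y L h = trans (reorder₁ c X a b) (trans (cong suc h) (reorder₂ c0 K Y L))
        where
        reorder₁ : ∀ c X a b → suc c + X + a + b ≡ suc (c + (X + 0) + a + b)
        reorder₁ = solve-∀
        reorder₂ : ∀ c0 K Y L → suc (c0 + K + Y + L) ≡ c0 + (K + 0) + Y + (L + 1)
        reorder₂ = solve-∀
      count′ : suc c + smalls (suc h) + smalls 2 + larges 2 ≡ c0 + smalls (suc k) + smalls (suc R) + larges (suc k)
      count′ rewrite kNotSmall | kLarge = arith c (smalls (suc h)) (smalls 2) (larges 2) c0 (smalls k) (smalls (suc R)) (larges k)
          (subst (λ z → c + (smalls (suc h) + 𝟙 z) + smalls 2 + larges 2 ≡ c0 + smalls k + smalls (suc R) + larges k) g'NotSmall count₀)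

  current : ∀ {A l g k c f b} (test : ℕ → Bool) → Invariant A l g k c f → (k ≤ᵇ g) ≡ true → test (A0 k) ≡ b → test (A k) ≡ b
  current test inv k≤?g e = trans (cong test (Invariant.untouched inv _ ≤-refl (≤ᵇ⇒≤′ k≤?g))) e

  via : ∀ f {s s′} → s ≡ s′ → Final (St.cnt (loop f p q s′)) → Final (St.cnt (loop f p q s))
  via f refl r = r

  loop-count : ∀ f A l g k c → Invariant A l g k c f → Final (St.cnt (loop f p q (st A l g k c)))
  loop-large : ∀ f A l g k c → Invariant A l g k c (suc f) → k ≤ g → (A0 k <ᵇ p) ≡ false → (q <ᵇ A0 k) ≡ true →
               Final (St.cnt (loop f p q (afterLarge p A l k c (innerWhile g q A k g))))

  loop-count zero A l g k c inv = ⊥-elim (<-irrefl refl (≤-trans enoughFuel k≤1+g))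
    where open Invariant inv
  loop-count (suc f) A l g k c inv with k ≤ᵇ g in k≤?g
  ... | false = final-exit inv (≤-antisym (Invariant.k≤1+g inv) (¬≤ᵇ⇒> k≤?g))
  ... | true with A0 k <ᵇ p in kSmall | q <ᵇ A0 k in kLarge
  ...   | true  | _     = via f (StepCases.step-small p q A l g k c (current (_<ᵇ p) inv k≤?g kSmall))
                            (loop-count f _ _ _ _ _ (inv-small inv (≤ᵇ⇒≤′ k≤?g) kSmall))
  ...   | false | false = via f (StepCases.step-medium p q A l g k c (current (_<ᵇ p) inv k≤?g kSmall) (current (q <ᵇ_) inv k≤?g kLarge))
                            (loop-count f _ _ _ _ _ (inv-medium inv (≤ᵇ⇒≤′ k≤?g) kSmall kLarge))
  ...   | false | true  = via f (StepCases.step-large p q A l g k c (current (_<ᵇ p) inv k≤?g kSmall) (current (q <ᵇ_) inv k≤?g kLarge))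
                            (loop-large f A l g k c inv (≤ᵇ⇒≤′ k≤?g) kSmall kLarge)

  loop-large f A l g k c inv k≤g kNotSmall kLarge
    with innerWhile g q A k g | innerWhile-stops q g A k g k≤g (m≤m+n g k)
  ... | zero  | stop = ⊥-elim (<⇒≱ (≤-trans (Invariant.2≤k inv) (InnerStop.k≤g' stop)) z≤n)
  ... | suc h | stop with suc h ≟ k
  ...   | yes refl = via f (afterLarge-notSmall (suc h) (trans (cong (_<ᵇ p) (untouched (suc h) ≤-refl k≤g)) kNotSmall))
                       (subst (λ s → Final (St.cnt s)) (sym (loop-exit p q f (swap A (suc h) (suc h)) l h (suc (suc h)) (suc c) h+2≰h))
                          (final-exhausted inv k≤g allLarge))
    where
    open Invariant inv
    open StepCases p q A l g (suc h) c
    h+2≰h : (suc (suc h) ≤ᵇ h) ≡ false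
    h+2≰h = >⇒¬≤ᵇ (m<n⇒m<1+n (n<1+n h))
    allLarge : ∀ i → suc h ≤ i → i ≤ g → (q <ᵇ A0 i) ≡ true
    allLarge i g'≤i i≤g with m≤n⇒m<n∨m≡n g'≤i
    ... | inj₂ refl = kLarge
    ... | inj₁ g'<i = trans (cong (q <ᵇ_) (sym (untouched i (<⇒≤ g'<i) i≤g))) (InnerStop.largeAbove stop i g'<i i≤g)
  ...   | no g'≢k with A0 (suc h) <ᵇ p in g'Small
  ...     | true  = via f (afterLarge-small (suc h) (trans (cong (_<ᵇ p) A-g') g'Small))
                        (loop-count f _ _ _ _ _ (inv-swapSmall g'Small))
    where
    open StepCases p q A l g k c
    open SwapWithBack inv k≤g kNotSmall kLarge stop g'≢k
  ...     | false = via f (afterLarge-notSmall (suc h) (trans (cong (_<ᵇ p) A-g') g'Small))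
                        (loop-count f _ _ _ _ _ (inv-swapMedium g'Small))
    where
    open StepCases p q A l g k c
    open SwapWithBack inv k≤g kNotSmall kLarge stop g'≢k

  initial : Invariant A0 2 R 2 c0 (3 + m)
  initial = record
    { untouched  = λ _ _ _ → refl
    ; l≤k        = ≤-refl
    ; 2≤k        = ≤-refl
    ; k≤1+g      = s≤s (s≤s z≤n)
    ; g≤R        = ≤-refl
    ; enoughFuel = s≤s (s≤s (s≤s (≤-trans (n≤1+n (suc m)) (≤-reflexive (+-comm 2 m)))))
    ; count      = reorder c0 (smalls (suc R)) (smalls 2) (larges 2)
    ; balance    = refl
    ; boundary   = inj₁ refl
    }
    where
    reorder : ∀ c0 a b d → c0 + a + b + d ≡ c0 + b + a + d
    reorder = solve-∀

middleSwaps : ℕ → Array → ℕ → ℕ → ℕ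
middleSwaps m A p q =
  Σ< (suc m) (λ j → 𝟙 (A (2 + j) <ᵇ p))
  + Σ< (suc m) (λ j → 𝟙 (j <ᵇ suc (middleNonLarge m A q)) * 𝟙 (q <ᵇ A (2 + j)))

loopSwaps : ∀ m (A1 A : Array) c0 → A1 1 ≤ A1 (3 + m) → (∀ j → j < suc m → A1 (2 + j) ≡ A (2 + j)) →
            St.cnt (loop (3 + m) (A1 1) (A1 (3 + m)) (st A1 2 (2 + m) 2 c0)) + 2
              ≡ 2 + c0 + middleSwaps m A (A1 1) (A1 (3 + m))
loopSwaps m A1 A c0 p≤q agree =
  trans (rearrange _ (smalls 2) (larges 2) c0 middleSmalls middleLargeFront
          (trans (loop-count (3 + m) A1 2 (2 + m) 2 c0 initial) (cong₂ (λ a b → c0 + a + b) smallsSplit largesSplit)))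
        (cong₂ (λ a b → 2 + c0 + (a + b)) (Σ<-cong (suc m) (λ j j<1+m → cong (λ z → 𝟙 (z <ᵇ p)) (agree j j<1+m)))
                                        (Σ<-cong (suc m) (λ j j<1+m → cong₂ (λ y z → 𝟙 (j <ᵇ suc y) * 𝟙 (q <ᵇ z)) nonLargeEq (agree j j<1+m))))
  where
  p q : ℕ
  p = A1 1
  q = A1 (3 + m)
  open LoopAnalysis A1 p q m c0 p≤q
  middleSmalls middleLargeFront : ℕ
  middleSmalls = Σ< (suc m) (λ j → small (2 + j))
  middleLargeFront = Σ< (suc m) (λ j → 𝟙 (j <ᵇ suc middleNonLarges) * large (2 + j))
  smallsSplit : smalls (suc R) ≡ smalls 2 + middleSmalls
  smallsSplit = Σ<-split 2 (suc m) small
  largesSplit : largesUpTo (middleNonLarges + 2) ≡ larges 2 + middleLargeFront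
  largesSplit = trans (Σ<-split 2 (suc m) _) (cong₂ _+_ first (Σ<-cong (suc m) (λ j _ → cong (λ z → 𝟙 z * large (2 + j)) (shift j))))
    where
    first : Σ< 2 (λ i → 𝟙 (i ≤ᵇ middleNonLarges + 2) * large i) ≡ larges 2
    first rewrite ≤⇒≤ᵇ′ {1} {middleNonLarges + 2} (≤-trans (s≤s z≤n) (m≤n+m 2 middleNonLarges)) =
      cong₂ _+_ (+-identityʳ (large 0)) (+-identityʳ (large 1))
    shift : ∀ j → (2 + j ≤ᵇ middleNonLarges + 2) ≡ (j <ᵇ suc middleNonLarges)
    shift j rewrite +-comm middleNonLarges 2 = refl
  nonLargeEq : middleNonLarges ≡ middleNonLarge m A q
  nonLargeEq = Σ<-cong (suc m) (λ j j<1+m → cong (λ z → 𝟙 (not (q <ᵇ z))) (agree j j<1+m))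
  rearrange : ∀ x a b c0 s t → x + a + b ≡ c0 + (a + s) + (b + t) → x + 2 ≡ 2 + c0 + (s + t)
  rearrange x a b c0 s t h = +-cancelʳ-≡ (a + b) _ _ (trans (reorder₁ x a b) (trans (cong (_+ 2) h) (reorder₂ c0 a s b t)))
    where
    reorder₁ : ∀ x a b → x + 2 + (a + b) ≡ x + a + b + 2
    reorder₁ = solve-∀
    reorder₂ : ∀ c0 a s b t → c0 + (a + s) + (b + t) + 2 ≡ 2 + c0 + (s + t) + (a + b)
    reorder₂ = solve-∀

firstStepSwaps-formula : ∀ m A → firstStepSwapsFrom (3 + m) A
  ≡ 2 + 𝟙 (A (3 + m) <ᵇ A 1) + middleSwaps m A (A 1 ⊓ A (3 + m)) (A 1 ⊔ A (3 + m))
firstStepSwaps-formula m A with A (3 + m) <ᵇ A 1 in swapped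
... | true = trans (loopSwaps m (swap A 1 (3 + m)) A 1 p≤q middle)
                   (cong₂ (λ p q → 2 + 1 + middleSwaps m A p q) (sym (m≥n⇒m⊓n≡n y≤x))
                          (trans (swap-at-j A 1 (3 + m)) (sym (m≥n⇒m⊔n≡m y≤x))))
  where
  y≤x : A (3 + m) ≤ A 1
  y≤x = <⇒≤ (<ᵇ⇒<′ swapped)
  p≤q : swap A 1 (3 + m) 1 ≤ swap A 1 (3 + m) (3 + m)
  p≤q = subst (A (3 + m) ≤_) (sym (swap-at-j A 1 (3 + m))) y≤x
  middle : ∀ j → j < suc m → swap A 1 (3 + m) (2 + j) ≡ A (2 + j)
  middle j j<1+m = swap-elsewhere A 1 (3 + m) (2 + j) (λ ()) (λ 2+j≡3+m → <-irrefl (suc-injective (suc-injective 2+j≡3+m)) j<1+m)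
... | false = trans (loopSwaps m A A 0 x≤y (λ _ _ → refl))
                    (cong₂ (λ p q → 2 + 0 + middleSwaps m A p q) (sym (m≤n⇒m⊓n≡m x≤y)) (sym (m≤n⇒m⊔n≡n x≤y)))
  where
  x≤y : A 1 ≤ A (3 + m)
  x≤y = ¬<ᵇ⇒≥ swapped

insertAt : ℕ → ℕ → List ℕ → List ℕ
insertAt zero    x ys       = x ∷ ys
insertAt (suc t) x []       = x ∷ []
insertAt (suc t) x (y ∷ ys) = y ∷ insertAt t x ys

ΣL-insertions : ∀ x ys g → ΣL (insertions x ys) g ≡ Σ< (suc (length ys)) (λ t → g (insertAt t x ys))
ΣL-insertions x []       g = +-identityʳ _
ΣL-insertions x (y ∷ ys) g = begin
  g (x ∷ y ∷ ys) + ΣL (map (y ∷_) (insertions x ys)) g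
    ≡⟨ cong (_+_ (g (x ∷ y ∷ ys))) (ΣL-map (insertions x ys) (y ∷_) g) ⟩
  g (x ∷ y ∷ ys) + ΣL (insertions x ys) (λ zs → g (y ∷ zs))
    ≡⟨ cong (_+_ (g (x ∷ y ∷ ys))) (ΣL-insertions x ys (λ zs → g (y ∷ zs))) ⟩
  g (x ∷ y ∷ ys) + Σ< (suc (length ys)) (λ t → g (y ∷ insertAt t x ys))
    ≡⟨ Σ<-head (suc (length ys)) (λ t → g (insertAt t x (y ∷ ys))) ⟨
  Σ< (suc (length (y ∷ ys))) (λ t → g (insertAt t x (y ∷ ys)))  ∎
  where open ≡-Reasoning

All-insertions : ∀ {R : List ℕ → Set} x ys → (∀ t → t ≤ length ys → R (insertAt t x ys)) → All R (insertions x ys)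
All-insertions x []       r = r 0 z≤n ∷ []
All-insertions x (y ∷ ys) r = r 0 z≤n ∷ map⁺ (All-insertions x ys (λ t t≤ → r (suc t) (s≤s t≤)))

length-insertAt : ∀ t x ys → length (insertAt t x ys) ≡ suc (length ys)
length-insertAt zero    x ys       = refl
length-insertAt (suc t) x []       = refl
length-insertAt (suc t) x (y ∷ ys) = cong suc (length-insertAt t x ys)

ΣL-insertAt : ∀ t x ys f → ΣL (insertAt t x ys) f ≡ f x + ΣL ys f
ΣL-insertAt zero    x ys       f = refl
ΣL-insertAt (suc t) x []       f = refl
ΣL-insertAt (suc t) x (y ∷ ys) f rewrite ΣL-insertAt t x ys f = +-comm-middle (f y) (f x) (ΣL ys f)
  where
  +-comm-middle : ∀ a b c → a + (b + c) ≡ b + (a + c)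
  +-comm-middle = solve-∀

All-insertAt : ∀ {R : ℕ → Set} t x ys → R x → All R ys → All R (insertAt t x ys)
All-insertAt zero    x ys       rx rys         = rx ∷ rys
All-insertAt (suc t) x []       rx []          = rx ∷ []
All-insertAt (suc t) x (y ∷ ys) rx (ry ∷ rys) = ry ∷ All-insertAt t x ys rx rys

-- skip t i is the position in ys of the entry at position i ≠ t of insertAt t x ys.
skip : ℕ → ℕ → ℕ
skip zero    i       = pred i
skip (suc t) zero    = zero
skip (suc t) (suc i) = suc (skip t i)

nth-insertAt : ∀ t x ys i → t ≤ length ys → nth (insertAt t x ys) i ≡ (if i ≡ᵇ t then x else nth ys (skip t i))
nth-insertAt zero    x ys       zero    _   = refl
nth-insertAt zero    x ys       (suc i) _   = refl
nth-insertAt (suc t) x (y ∷ ys) zero    _   = refl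
nth-insertAt (suc t) x (y ∷ ys) (suc i) t≤ = nth-insertAt t x ys i (s≤s⁻¹ t≤)

skip-bound : ∀ n t i → i < suc n → i ≢ t → t ≤ n → skip t i < n
skip-bound n       zero    zero    _   0≢0 _   = ⊥-elim (0≢0 refl)
skip-bound n       zero    (suc i) i<  _   _   = s≤s⁻¹ i<
skip-bound (suc n) (suc t) zero    _   _   _   = s≤s z≤n
skip-bound (suc n) (suc t) (suc i) i<  i≢t t≤n =
  s≤s (skip-bound n t i (s≤s⁻¹ i<) (λ i≡t → i≢t (cong suc i≡t)) (s≤s⁻¹ t≤n))

skip-injective : ∀ t i j → i ≢ t → j ≢ t → i ≢ j → skip t i ≢ skip t j
skip-injective zero    zero    _       0≢0 _   _   _  = 0≢0 refl
skip-injective zero    (suc i) zero    _   0≢0 _   _  = 0≢0 refl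
skip-injective zero    (suc i) (suc j) _   _   i≢j eq = i≢j (cong suc eq)
skip-injective (suc t) zero    zero    _   _   i≢j _  = i≢j refl
skip-injective (suc t) zero    (suc j) _   _   _   ()
skip-injective (suc t) (suc i) zero    _   _   _   ()
skip-injective (suc t) (suc i) (suc j) i≢t j≢t i≢j eq =
  skip-injective t i j (λ e → i≢t (cong suc e)) (λ e → j≢t (cong suc e)) (λ e → i≢j (cong suc e)) (suc-injective eq)

nth-≤ : ∀ n ys i → All (_≤ n) ys → nth ys i ≤ n
nth-≤ n []       i       _          = z≤n
nth-≤ n (y ∷ ys) zero    (y≤n ∷ _)  = y≤n
nth-≤ n (y ∷ ys) (suc i) (_ ∷ ys≤n) = nth-≤ n ys i ys≤n

nth-All : ∀ {R : ℕ → Set} ys i → All R ys → i < length ys → R (nth ys i)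
nth-All (y ∷ ys) zero    (ry ∷ _)   _  = ry
nth-All (y ∷ ys) (suc i) (_ ∷ rys) i< = nth-All ys i rys (s<s⁻¹ i<)

perm-induction : (R : ℕ → List ℕ → Set) → R 0 [] →
                 (∀ n P → R n P → ∀ t → t ≤ length P → R (suc n) (insertAt t (suc n) P)) →
                 ∀ n → All (R n) (permutations n)
perm-induction R base grow zero    = base ∷ []
perm-induction R base grow (suc n) =
  concat⁺ (map⁺ (All.map (λ {P} rP → All-insertions (suc n) P (grow n P rP)) (perm-induction R base grow n)))

WellFormed : ℕ → List ℕ → Set
WellFormed n P = length P ≡ n × All (λ v → 1 ≤ v × v ≤ n) P

wellFormed-insertAt : ∀ n P → WellFormed n P → ∀ t → WellFormed (suc n) (insertAt t (suc n) P)
wellFormed-insertAt n P (len , range) t =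
  trans (length-insertAt t (suc n) P) (cong suc len) ,
  All-insertAt t (suc n) P (s≤s z≤n , ≤-refl) (All.map (λ (1≤v , v≤n) → 1≤v , m≤n⇒m≤1+n v≤n) range)

perms-wellFormed : ∀ n → All (WellFormed n) (permutations n)
perms-wellFormed = perm-induction WellFormed (refl , []) (λ n P wf t _ → wellFormed-insertAt n P wf t)

wellFormed-≤ : ∀ {n P} → WellFormed n P → All (_≤ n) P
wellFormed-≤ (_ , range) = All.map proj₂ range

Count≤ : ℕ → List ℕ → Set
Count≤ n P = ∀ u → ΣL P (λ v → 𝟙 (v ≤ᵇ u)) ≡ u ⊓ n

perms-count≤ : ∀ n → All (Count≤ n) (permutations n)
perms-count≤ = perm-induction Count≤ (λ u → sym (⊓-zeroʳ u)) grow
  where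
  newEntry : ∀ n u → 𝟙 (suc n ≤ᵇ u) + u ⊓ n ≡ u ⊓ suc n
  newEntry n u with suc n ≤? u
  ... | yes n<u rewrite ≤⇒≤ᵇ′ n<u | m≥n⇒m⊓n≡n (≤-trans (n≤1+n n) n<u) | m≥n⇒m⊓n≡n n<u = refl
  ... | no  n≮u rewrite >⇒¬≤ᵇ {suc n} {u} (≰⇒> n≮u) | m≤n⇒m⊓n≡m (s≤s⁻¹ (≰⇒> n≮u)) | m≤n⇒m⊓n≡m (<⇒≤ (≰⇒> n≮u)) = refl
  grow : ∀ n P → Count≤ n P → ∀ t → t ≤ length P → Count≤ (suc n) (insertAt t (suc n) P)
  grow n P count t _ u = trans (ΣL-insertAt t (suc n) P _) (trans (cong (_+_ (𝟙 (suc n ≤ᵇ u))) (count u)) (newEntry n u))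

Distinct : ℕ → List ℕ → Set
Distinct n P = ∀ i j → i ≢ j → i < n → j < n → nth P i ≢ nth P j

perms-distinct : ∀ n → All (Distinct n) (permutations n)
perms-distinct n = All.map proj₂ (perm-induction (λ n P → WellFormed n P × Distinct n P) ((refl , []) , λ _ _ _ ()) grow n)
  where
  grow : ∀ n P → WellFormed n P × Distinct n P → ∀ t → t ≤ length P →
         WellFormed (suc n) (insertAt t (suc n) P) × Distinct (suc n) (insertAt t (suc n) P)
  grow n P (wf@(len , range) , distinct) t t≤len = wellFormed-insertAt n P wf t , distinct′
    where
    t≤n : t ≤ n
    t≤n = subst (t ≤_) len t≤len
    old≢new : ∀ i → nth P (skip t i) ≢ suc n
    old≢new i eq = <-irrefl eq (s≤s (nth-≤ n P (skip t i) (wellFormed-≤ wf)))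
    distinct′ : Distinct (suc n) (insertAt t (suc n) P)
    distinct′ i j i≢j i< j< rewrite nth-insertAt t (suc n) P i t≤len | nth-insertAt t (suc n) P j t≤len
      with i ≡ᵇ t in i≟t | j ≡ᵇ t in j≟t
    ... | true  | true  = ⊥-elim (i≢j (trans (≡ᵇ⇒≡′ i≟t) (sym (≡ᵇ⇒≡′ j≟t))))
    ... | true  | false = λ eq → old≢new j (sym eq)
    ... | false | true  = old≢new i
    ... | false | false =
      distinct (skip t i) (skip t j) (skip-injective t i j (¬≡ᵇ⇒≢ i≟t) (¬≡ᵇ⇒≢ j≟t) i≢j)
        (skip-bound n t i i< (¬≡ᵇ⇒≢ i≟t) t≤n) (skip-bound n t j j< (¬≡ᵇ⇒≢ j≟t) t≤n)

-- A constraint (i , v) asks for the entry v at (0-based) position i.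
Constraint : Set
Constraint = ℕ × ℕ

satisfies : List ℕ → List Constraint → Bool
satisfies P []             = true
satisfies P ((i , v) ∷ cs) = (nth P i ≡ᵇ v) ∧ satisfies P cs

matching : ℕ → List Constraint → ℕ
matching n cs = ΣL (permutations n) (λ P → 𝟙 (satisfies P cs))

InBounds : ℕ → List Constraint → Set
InBounds n cs = All (λ c → proj₁ c < n × 1 ≤ proj₂ c × proj₂ c ≤ n) cs

DistinctPositions : List Constraint → Set
DistinctPositions []             = ⊤
DistinctPositions ((i , v) ∷ cs) = All (λ c → proj₁ c ≢ i) cs × DistinctPositions cs

-- Listing the constraints by decreasing value makes the values distinct and
-- puts a constraint on the largest entry n at the head.
DecreasingValues : List Constraint → Set
DecreasingValues []             = ⊤
DecreasingValues ((i , v) ∷ cs) = All (λ c → proj₂ c < v) cs × DecreasingValues cs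

avoids : ℕ → List Constraint → Bool
avoids t []             = true
avoids t ((i , v) ∷ cs) = not (i ≡ᵇ t) ∧ avoids t cs

avoids⇒≢ : ∀ t cs → avoids t cs ≡ true → All (λ c → proj₁ c ≢ t) cs
avoids⇒≢ t []             _ = []
avoids⇒≢ t ((i , v) ∷ cs) a with i ≡ᵇ t in i≟t
... | false = ¬≡ᵇ⇒≢ i≟t ∷ avoids⇒≢ t cs a

≢⇒avoids : ∀ t cs → All (λ c → proj₁ c ≢ t) cs → avoids t cs ≡ true
≢⇒avoids t []             []           = refl
≢⇒avoids t ((i , v) ∷ cs) (i≢t ∷ rest) rewrite ≢⇒¬≡ᵇ i≢t = ≢⇒avoids t cs rest

𝟙-∧ : ∀ a b → 𝟙 (a ∧ b) ≡ 𝟙 a * 𝟙 b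
𝟙-∧ true  b = sym (+-identityʳ (𝟙 b))
𝟙-∧ false b = refl

∧-interchange : ∀ a b c d → (a ∧ b) ∧ (c ∧ d) ≡ (a ∧ c) ∧ (b ∧ d)
∧-interchange true  b     true  d = refl
∧-interchange true  true  false d = refl
∧-interchange true  false false d = refl
∧-interchange false b     c     d = refl

free-positions : ∀ m cs → DistinctPositions cs → All (λ c → proj₁ c < m) cs →
                 Σ< m (λ t → 𝟙 (avoids t cs)) + length cs ≡ m
free-positions m []             _           _ = trans (+-identityʳ _) (trans (Σ<-const m 1) (*-identityʳ m))
free-positions m ((i , v) ∷ cs) (i∉cs , dp) (i<m ∷ cs<m) = begin
  Σ< m (λ t → 𝟙 (not (i ≡ᵇ t) ∧ avoids t cs)) + suc (length cs)
    ≡⟨ +-suc _ (length cs) ⟩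
  suc (Σ< m (λ t → 𝟙 (not (i ≡ᵇ t) ∧ avoids t cs))) + length cs
    ≡⟨ cong (_+ length cs) (trans (+-comm 1 _) (cong (_+_ (Σ< m _)) (sym one))) ⟩
  Σ< m (λ t → 𝟙 (not (i ≡ᵇ t) ∧ avoids t cs)) + Σ< m (λ t → 𝟙 (i ≡ᵇ t) * 𝟙 (avoids t cs)) + length cs
    ≡⟨ cong (_+ length cs) (trans (sym (Σ<-+ m _ _)) (Σ<-cong m (λ t _ → split (i ≡ᵇ t) (avoids t cs)))) ⟩
  Σ< m (λ t → 𝟙 (avoids t cs)) + length cs
    ≡⟨ free-positions m cs dp cs<m ⟩
  m ∎
  where
  open ≡-Reasoning
  one : Σ< m (λ t → 𝟙 (i ≡ᵇ t) * 𝟙 (avoids t cs)) ≡ 1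
  one = trans (Σ<-δ m i (λ t → 𝟙 (avoids t cs)) i<m) (cong 𝟙 (≢⇒avoids i cs i∉cs))
  split : ∀ a b → 𝟙 (not a ∧ b) + 𝟙 a * 𝟙 b ≡ 𝟙 b
  split true  true  = refl
  split true  false = refl
  split false true  = refl
  split false false = refl

constraints-fit : ∀ u cs → All (λ c → 1 ≤ proj₂ c × proj₂ c ≤ u) cs → DecreasingValues cs → length cs ≤ u
constraints-fit u []                  _                     _              = z≤n
constraints-fit u ((i , suc w) ∷ cs) ((_ , 1+w≤u) ∷ range) (below , dec) =
  ≤-trans (s≤s (constraints-fit w cs (All.zipWith (λ ((1≤v , _) , v<1+w) → 1≤v , s≤s⁻¹ v<1+w) (range , below)) dec)) 1+w≤u

skipAll : ℕ → List Constraint → List Constraint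
skipAll t = map (λ c → skip t (proj₁ c) , proj₂ c)

module _ (n t : ℕ) (t≤n : t ≤ n) where

  skipAll-inBounds : ∀ cs → InBounds (suc n) cs → All (λ c → proj₂ c ≤ n) cs → All (λ c → proj₁ c ≢ t) cs →
                     InBounds n (skipAll t cs)
  skipAll-inBounds []             []                       []           []           = []
  skipAll-inBounds ((i , v) ∷ cs) ((i< , 1≤v , _) ∷ bnd) (v≤n ∷ cs≤n) (i≢t ∷ cs≢t) =
    (skip-bound n t i i< i≢t t≤n , 1≤v , v≤n) ∷ skipAll-inBounds cs bnd cs≤n cs≢t

skipAll-distinct : ∀ t cs → DistinctPositions cs → All (λ c → proj₁ c ≢ t) cs → DistinctPositions (skipAll t cs)
skipAll-distinct t []             _            _            = tt
skipAll-distinct t ((i , v) ∷ cs) (i∉cs , dp) (i≢t ∷ cs≢t) =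
  map⁺ (All.zipWith (λ (j≢i , j≢t) → skip-injective t _ i j≢t i≢t j≢i) (i∉cs , cs≢t)) , skipAll-distinct t cs dp cs≢t

skipAll-decreasing : ∀ t cs → DecreasingValues cs → DecreasingValues (skipAll t cs)
skipAll-decreasing t []             _            = tt
skipAll-decreasing t ((i , v) ∷ cs) (below , dec) = map⁺ below , skipAll-decreasing t cs dec

module Inserted (n : ℕ) (P : List ℕ) (wf : WellFormed n P) (t : ℕ) (t≤n : t ≤ n) where

  t≤len : t ≤ length P
  t≤len = subst (t ≤_) (sym (proj₁ wf)) t≤n

  entry-old : ∀ i v → v ≤ n → (nth (insertAt t (suc n) P) i ≡ᵇ v) ≡ not (i ≡ᵇ t) ∧ (nth P (skip t i) ≡ᵇ v)
  entry-old i v v≤n rewrite nth-insertAt t (suc n) P i t≤len with i ≡ᵇ t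
  ... | true  = ≢⇒¬≡ᵇ (λ n+1≡v → <-irrefl (sym n+1≡v) (s≤s v≤n))
  ... | false = refl

  entry-new : ∀ i → (nth (insertAt t (suc n) P) i ≡ᵇ suc n) ≡ (i ≡ᵇ t)
  entry-new i rewrite nth-insertAt t (suc n) P i t≤len with i ≡ᵇ t
  ... | true  = ≡ᵇ-refl (suc n)
  ... | false = ≢⇒¬≡ᵇ (λ eq → <-irrefl eq (s≤s (nth-≤ n P (skip t i) (wellFormed-≤ wf))))

  satisfies-old : ∀ cs → All (λ c → proj₂ c ≤ n) cs →
                  satisfies (insertAt t (suc n) P) cs ≡ avoids t cs ∧ satisfies P (skipAll t cs)
  satisfies-old []             []          = refl
  satisfies-old ((i , v) ∷ cs) (v≤n ∷ rest) rewrite entry-old i v v≤n | satisfies-old cs rest =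
    ∧-interchange (not (i ≡ᵇ t)) _ _ _

matching-suc : ∀ n cs → matching (suc n) cs ≡ ΣL (permutations n) (λ P → Σ< (suc n) (λ t → 𝟙 (satisfies (insertAt t (suc n) P) cs)))
matching-suc n cs = trans (ΣL-concatMap (permutations n) (insertions (suc n)) _)
  (ΣL-congᴬ (permutations n) (All.map (λ {P} wf → trans (ΣL-insertions (suc n) P _)
                                                    (cong (λ z → Σ< (suc z) (λ t → 𝟙 (satisfies (insertAt t (suc n) P) cs))) (proj₁ wf)))
                                      (perms-wellFormed n)))

Counting : ℕ → Set
Counting n = ∀ cs → InBounds n cs → DistinctPositions cs → DecreasingValues cs → matching n cs ≡ (n ∸ length cs) !

-- No constraint asks for the new entry n + 1: it may go to any of the
-- suc n - k free positions, and the rest is counted by induction.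
count-free : ∀ n → Counting n → ∀ cs → InBounds (suc n) cs → DistinctPositions cs → DecreasingValues cs →
             All (λ c → proj₂ c ≤ n) cs → matching (suc n) cs ≡ (suc n ∸ length cs) !
count-free n ih cs bnd dp dec cs≤n = begin
  matching (suc n) cs
    ≡⟨ matching-suc n cs ⟩
  ΣL perms (λ P → Σ< (suc n) (λ t → 𝟙 (satisfies (insertAt t (suc n) P) cs)))
    ≡⟨ ΣL-congᴬ perms (All.map (λ {P} wf → Σ<-cong (suc n) (λ t t<1+n → split P wf t (s≤s⁻¹ t<1+n))) (perms-wellFormed n)) ⟩
  ΣL perms (λ P → Σ< (suc n) (λ t → 𝟙 (avoids t cs) * 𝟙 (satisfies P (skipAll t cs))))
    ≡⟨ ΣL-Σ< perms (suc n) _ ⟩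
  Σ< (suc n) (λ t → ΣL perms (λ P → 𝟙 (avoids t cs) * 𝟙 (satisfies P (skipAll t cs))))
    ≡⟨ Σ<-cong (suc n) (λ t _ → ΣL-*ˡ perms (𝟙 (avoids t cs)) _) ⟩
  Σ< (suc n) (λ t → 𝟙 (avoids t cs) * matching n (skipAll t cs))
    ≡⟨ Σ<-cong (suc n) (λ t t<1+n → atPosition t (s≤s⁻¹ t<1+n)) ⟩
  Σ< (suc n) (λ t → 𝟙 (avoids t cs) * (n ∸ k) !)
    ≡⟨ Σ<-*ʳ (suc n) _ _ ⟩
  Σ< (suc n) (λ t → 𝟙 (avoids t cs)) * (n ∸ k) !
    ≡⟨ cong (_* (n ∸ k) !) free ⟩
  (suc n ∸ k) * (n ∸ k) !
    ≡⟨ cong (λ z → z * (n ∸ k) !) (+-∸-assoc 1 k≤n) ⟩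
  (suc (n ∸ k)) !
    ≡⟨ cong _! (+-∸-assoc 1 k≤n) ⟨
  (suc n ∸ k) ! ∎
  where
  open ≡-Reasoning
  perms : List (List ℕ)
  perms = permutations n
  k : ℕ
  k = length cs
  k≤n : k ≤ n
  k≤n = constraints-fit n cs (All.zipWith (λ ((_ , 1≤v , _) , v≤n) → 1≤v , v≤n) (bnd , cs≤n)) dec
  free : Σ< (suc n) (λ t → 𝟙 (avoids t cs)) ≡ suc n ∸ k
  free = trans (sym (m+n∸n≡m _ k)) (cong (_∸ k) (free-positions (suc n) cs dp (All.map proj₁ bnd)))
  split : ∀ P → WellFormed n P → ∀ t → t ≤ n →
          𝟙 (satisfies (insertAt t (suc n) P) cs) ≡ 𝟙 (avoids t cs) * 𝟙 (satisfies P (skipAll t cs))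
  split P wf t t≤n = trans (cong 𝟙 (Inserted.satisfies-old n P wf t t≤n cs cs≤n)) (𝟙-∧ (avoids t cs) _)
  atPosition : ∀ t → t ≤ n → 𝟙 (avoids t cs) * matching n (skipAll t cs) ≡ 𝟙 (avoids t cs) * (n ∸ k) !
  atPosition t t≤n with avoids t cs in t-free
  ... | false = refl
  ... | true  = cong (1 *_) (trans (ih (skipAll t cs) (skipAll-inBounds n t t≤n cs bnd cs≤n t∉cs)
                                       (skipAll-distinct t cs dp t∉cs) (skipAll-decreasing t cs dec))
                                   (cong (λ z → (n ∸ z) !) (length-map _ cs)))
    where
    t∉cs : All (λ c → proj₁ c ≢ t) cs
    t∉cs = avoids⇒≢ t cs t-free

-- The head constraint asks for the new entry n + 1 at position i: it must be
-- inserted exactly there, and the remaining constraints are counted by induction.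
count-new : ∀ n → Counting n → ∀ i cs → InBounds (suc n) ((i , suc n) ∷ cs) →
            DistinctPositions ((i , suc n) ∷ cs) → DecreasingValues ((i , suc n) ∷ cs) →
            matching (suc n) ((i , suc n) ∷ cs) ≡ (n ∸ length cs) !
count-new n ih i cs ((i<1+n , _) ∷ bnd) (i∉cs , dp) (below , dec) = begin
  matching (suc n) ((i , suc n) ∷ cs)
    ≡⟨ matching-suc n ((i , suc n) ∷ cs) ⟩
  ΣL (permutations n) (λ P → Σ< (suc n) (λ t → 𝟙 (satisfies (insertAt t (suc n) P) ((i , suc n) ∷ cs))))
    ≡⟨ ΣL-congᴬ (permutations n) (All.map (λ {P} → onlyAt-i P) (perms-wellFormed n)) ⟩
  matching n (skipAll i cs)
    ≡⟨ ih (skipAll i cs) (skipAll-inBounds n i i≤n cs bnd cs≤n i∉cs) (skipAll-distinct i cs dp i∉cs) (skipAll-decreasing i cs dec) ⟩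
  (n ∸ length (skipAll i cs)) !
    ≡⟨ cong (λ z → (n ∸ z) !) (length-map _ cs) ⟩
  (n ∸ length cs) ! ∎
  where
  open ≡-Reasoning
  i≤n : i ≤ n
  i≤n = s≤s⁻¹ i<1+n
  cs≤n : All (λ c → proj₂ c ≤ n) cs
  cs≤n = All.map s≤s⁻¹ below
  onlyAt-i : ∀ P → WellFormed n P →
             Σ< (suc n) (λ t → 𝟙 (satisfies (insertAt t (suc n) P) ((i , suc n) ∷ cs))) ≡ 𝟙 (satisfies P (skipAll i cs))
  onlyAt-i P wf = begin
    Σ< (suc n) (λ t → 𝟙 (satisfies (insertAt t (suc n) P) ((i , suc n) ∷ cs)))
      ≡⟨ Σ<-cong (suc n) (λ t t<1+n → cong₂ (λ a b → 𝟙 (a ∧ b)) (Inserted.entry-new n P wf t (s≤s⁻¹ t<1+n) i)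
                                                              (Inserted.satisfies-old n P wf t (s≤s⁻¹ t<1+n) cs cs≤n)) ⟩
    Σ< (suc n) (λ t → 𝟙 ((i ≡ᵇ t) ∧ (avoids t cs ∧ satisfies P (skipAll t cs))))
      ≡⟨ Σ<-cong (suc n) (λ t _ → 𝟙-∧ (i ≡ᵇ t) _) ⟩
    Σ< (suc n) (λ t → 𝟙 (i ≡ᵇ t) * 𝟙 (avoids t cs ∧ satisfies P (skipAll t cs)))
      ≡⟨ Σ<-δ (suc n) i (λ t → 𝟙 (avoids t cs ∧ satisfies P (skipAll t cs))) i<1+n ⟩
    𝟙 (avoids i cs ∧ satisfies P (skipAll i cs))
      ≡⟨ cong (λ a → 𝟙 (a ∧ satisfies P (skipAll i cs))) (≢⇒avoids i cs i∉cs) ⟩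
    𝟙 (satisfies P (skipAll i cs)) ∎

matching-count : ∀ n → Counting n
matching-count zero    []       _                    _  _   = refl
matching-count zero    (c ∷ cs) ((() , _) ∷ _)       _  _
matching-count (suc n) []       _                    _  _   = count-free n (matching-count n) [] [] tt tt []
matching-count (suc n) ((i , v) ∷ cs) bnd@((_ , _ , v≤1+n) ∷ _) dp dec@(below , _) with m≤n⇒m<n∨m≡n v≤1+n
... | inj₂ refl = count-new n (matching-count n) i cs bnd dp dec
... | inj₁ v<1+n = count-free n (matching-count n) ((i , v) ∷ cs) bnd dp dec
                    (s≤s⁻¹ v<1+n ∷ All.map (λ u<v → ≤-trans (<⇒≤ u<v) (s≤s⁻¹ v<1+n)) below)

-- The swaps caused by the pivot entries x = A[1] and y = A[n]: the initial
-- swap iff y < x, and one swap for each of the min(x, y) - 1 small entries.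
pivotTerm : ℕ → ℕ → ℕ
pivotTerm x y = 𝟙 (y <ᵇ x) + (x ⊓ y ∸ 1)

-- The swap caused by the middle position 2 + j holding z: one iff z is large
-- and the position is among the first max(x, y) - 1 middle positions.
middleTerm : ℕ → ℕ → ℕ → ℕ → ℕ
middleTerm j x y z = 𝟙 (j <ᵇ x ⊔ y ∸ 1) * 𝟙 (x ⊔ y <ᵇ z)

ΣL-nth : ∀ P (g : ℕ → ℕ) → ΣL P g ≡ Σ< (length P) (λ j → g (nth P j))
ΣL-nth []       g = refl
ΣL-nth (x ∷ xs) g = trans (cong (_+_ (g x)) (ΣL-nth xs g)) (sym (Σ<-head (length xs) (λ j → g (nth (x ∷ xs) j))))

ΣL-ends : ∀ m (g : ℕ → ℕ) P → length P ≡ 3 + m →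
          ΣL P g ≡ g (nth P 0) + Σ< (suc m) (λ j → g (nth P (suc j))) + g (nth P (2 + m))
ΣL-ends m g P len = begin
  ΣL P g                                                        ≡⟨ ΣL-nth P g ⟩
  Σ< (length P) (λ j → g (nth P j))                             ≡⟨ cong (λ z → Σ< z (λ j → g (nth P j))) len ⟩
  Σ< (2 + m) (λ j → g (nth P j)) + g (nth P (2 + m))            ≡⟨ cong (_+ g (nth P (2 + m))) (Σ<-head (suc m) (λ j → g (nth P j))) ⟩
  g (nth P 0) + Σ< (suc m) (λ j → g (nth P (suc j))) + g (nth P (2 + m)) ∎
  where open ≡-Reasoning

<ᵇ-suc : ∀ v u → (v <ᵇ suc u) ≡ (v ≤ᵇ u)
<ᵇ-suc zero    u = refl
<ᵇ-suc (suc v) u = refl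

not-<ᵇ : ∀ q v → not (q <ᵇ v) ≡ (v ≤ᵇ q)
not-<ᵇ q v with q <ᵇ v in e
... | true  = sym (>⇒¬≤ᵇ {v} {q} (<ᵇ⇒<′ e))
... | false = sym (≤⇒≤ᵇ′ {v} {q} (¬<ᵇ⇒≥ e))

-- For a permutation P of 1 .. m + 3 with first entry x and last entry y, the
-- numbers of small and non-large middle entries are determined by x and y,
-- so the swap count becomes a sum of pivot and middle terms.
module Ends (m : ℕ) (P : List ℕ) (wf : WellFormed (3 + m) P) (count≤ : Count≤ (3 + m) P) where

  x y : ℕ
  x = nth P 0
  y = nth P (2 + m)

  x-range : 1 ≤ x × x ≤ 3 + m
  x-range = nth-All P 0 (proj₂ wf) (subst (0 <_) (sym (proj₁ wf)) (s≤s z≤n))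

  y-range : 1 ≤ y × y ≤ 3 + m
  y-range = nth-All P (2 + m) (proj₂ wf) (subst (2 + m <_) (sym (proj₁ wf)) ≤-refl)

  middle≤ : ∀ u → 𝟙 (x ≤ᵇ u) + Σ< (suc m) (λ j → 𝟙 (nth P (suc j) ≤ᵇ u)) + 𝟙 (y ≤ᵇ u) ≡ u ⊓ (3 + m)
  middle≤ u = trans (sym (ΣL-ends m (λ v → 𝟙 (v ≤ᵇ u)) P (proj₁ wf))) (count≤ u)

  smallMiddle : Σ< (suc m) (λ j → 𝟙 (nth P (suc j) <ᵇ x ⊓ y)) ≡ x ⊓ y ∸ 1
  smallMiddle with x ⊓ y | m⊓n≤m x y | m⊓n≤n x y | ⊓-glb (proj₁ x-range) (proj₁ y-range)
  ... | zero  | _   | _   | ()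
  ... | suc u | p≤x | p≤y | _ = begin
    Σ< (suc m) (λ j → 𝟙 (nth P (suc j) <ᵇ suc u))
      ≡⟨ Σ<-cong (suc m) (λ j _ → cong 𝟙 (<ᵇ-suc (nth P (suc j)) u)) ⟩
    Σ< (suc m) (λ j → 𝟙 (nth P (suc j) ≤ᵇ u))
      ≡⟨ trans (cong₂ (λ a b → a + Σ< (suc m) (λ j → 𝟙 (nth P (suc j) ≤ᵇ u)) + b) xAbove yAbove) (+-identityʳ _) ⟨
    𝟙 (x ≤ᵇ u) + Σ< (suc m) (λ j → 𝟙 (nth P (suc j) ≤ᵇ u)) + 𝟙 (y ≤ᵇ u)
      ≡⟨ middle≤ u ⟩
    u ⊓ (3 + m)
      ≡⟨ m≤n⇒m⊓n≡m (≤-trans (n≤1+n u) (≤-trans p≤x (proj₂ x-range))) ⟩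
    u ∎
    where
    open ≡-Reasoning
    xAbove : 𝟙 (x ≤ᵇ u) ≡ 0
    xAbove = cong 𝟙 (>⇒¬≤ᵇ p≤x)
    yAbove : 𝟙 (y ≤ᵇ u) ≡ 0
    yAbove = cong 𝟙 (>⇒¬≤ᵇ p≤y)

  -- the non-large middle entries are the values ≤ max(x, y) other than x, y
  nonLargeMiddle : suc (middleNonLarge m (fromList P) (x ⊔ y)) ≡ x ⊔ y ∸ 1
  nonLargeMiddle = cancel (begin
    1 + middleNonLarge m (fromList P) q + 1
      ≡⟨ cong₂ (λ a b → a + middleNonLarge m (fromList P) q + b) (cong 𝟙 (≤⇒≤ᵇ′ (m≤m⊔n x y))) (cong 𝟙 (≤⇒≤ᵇ′ (m≤n⊔m x y))) ⟨
    𝟙 (x ≤ᵇ q) + middleNonLarge m (fromList P) q + 𝟙 (y ≤ᵇ q)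
      ≡⟨ cong (λ z → 𝟙 (x ≤ᵇ q) + z + 𝟙 (y ≤ᵇ q)) (Σ<-cong (suc m) (λ j _ → cong 𝟙 (not-<ᵇ q (nth P (suc j))))) ⟩
    𝟙 (x ≤ᵇ q) + Σ< (suc m) (λ j → 𝟙 (nth P (suc j) ≤ᵇ q)) + 𝟙 (y ≤ᵇ q)
      ≡⟨ middle≤ q ⟩
    q ⊓ (3 + m)
      ≡⟨ m≤n⇒m⊓n≡m (⊔-lub (proj₂ x-range) (proj₂ y-range)) ⟩
    q ∎)
    where
    open ≡-Reasoning
    q : ℕ
    q = x ⊔ y
    cancel : ∀ {a b} → 1 + a + 1 ≡ b → suc a ≡ b ∸ 1
    cancel {a} refl = sym (m+n∸n≡m (suc a) 1)

  swaps : firstStepSwaps (3 + m) P ≡ 2 + pivotTerm x y + Σ< (suc m) (λ j → middleTerm j x y (nth P (suc j)))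
  swaps = begin
    firstStepSwaps (3 + m) P
      ≡⟨ firstStepSwaps-formula m (fromList P) ⟩
    2 + 𝟙 (y <ᵇ x) + (Σ< (suc m) (λ j → 𝟙 (nth P (suc j) <ᵇ x ⊓ y))
                      + Σ< (suc m) (λ j → 𝟙 (j <ᵇ suc (middleNonLarge m (fromList P) (x ⊔ y))) * 𝟙 (x ⊔ y <ᵇ nth P (suc j))))
      ≡⟨ cong₂ (λ a b → 2 + 𝟙 (y <ᵇ x) + (a + Σ< (suc m) (λ j → 𝟙 (j <ᵇ b) * 𝟙 (x ⊔ y <ᵇ nth P (suc j))))) smallMiddle nonLargeMiddle ⟩
    2 + 𝟙 (y <ᵇ x) + (x ⊓ y ∸ 1 + Σ< (suc m) (λ j → middleTerm j x y (nth P (suc j))))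
      ≡⟨ reassoc 2 (𝟙 (y <ᵇ x)) (x ⊓ y ∸ 1) _ ⟩
    2 + pivotTerm x y + Σ< (suc m) (λ j → middleTerm j x y (nth P (suc j))) ∎
    where
    open ≡-Reasoning
    reassoc : ∀ a b c d → a + b + (c + d) ≡ a + (b + c) + d
    reassoc = solve-∀

at : List ℕ → ℕ → ℕ → ℕ
at P i v = 𝟙 (nth P i ≡ᵇ v)

offDiag : ℕ → ℕ → ℕ
offDiag a b = 𝟙 (not (a ≡ᵇ b))

𝟙-satisfies₂ : ∀ P i v j w → 𝟙 (satisfies P ((i , v) ∷ (j , w) ∷ [])) ≡ at P i v * at P j w
𝟙-satisfies₂ P i v j w with nth P i ≡ᵇ v | nth P j ≡ᵇ w
... | true  | true  = refl
... | true  | false = refl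
... | false | _     = refl

𝟙-satisfies₃ : ∀ P i v j w k u → 𝟙 (satisfies P ((i , v) ∷ (j , w) ∷ (k , u) ∷ [])) ≡ at P i v * at P j w * at P k u
𝟙-satisfies₃ P i v j w k u with nth P i ≡ᵇ v | nth P j ≡ᵇ w | nth P k ≡ᵇ u
... | true  | true  | true  = refl
... | true  | true  | false = refl
... | true  | false | _     = refl
... | false | _     | _     = refl

module Marginals (n : ℕ) where

  perms : List (List ℕ)
  perms = permutations n

  two-point : ∀ i j v w → i ≢ j → i < n → j < n → 1 ≤ w → w < v → v ≤ n →
              ΣL perms (λ P → at P i v * at P j w) ≡ (n ∸ 2) !
  two-point i j v w i≢j i<n j<n 1≤w w<v v≤n =
    trans (ΣL-cong perms (λ P → sym (𝟙-satisfies₂ P i v j w)))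
          (matching-count n ((i , v) ∷ (j , w) ∷ [])
            ((i<n , ≤-trans 1≤w (<⇒≤ w<v) , v≤n) ∷ (j<n , 1≤w , ≤-trans (<⇒≤ w<v) v≤n) ∷ [])
            (((λ j≡i → i≢j (sym j≡i)) ∷ []) , [] , tt) ((w<v ∷ []) , [] , tt))

  same-value : ∀ i j v → i ≢ j → i < n → j < n → ΣL perms (λ P → at P i v * at P j v) ≡ 0
  same-value i j v i≢j i<n j<n = ΣL-vanishing perms _ (All.map (λ {P} → never {P}) (perms-distinct n))
    where
    never : ∀ {P} → Distinct n P → at P i v * at P j v ≡ 0
    never {P} distinct with nth P i ≡ᵇ v in pi≟v | nth P j ≡ᵇ v in pj≟v
    ... | true  | true  = ⊥-elim (distinct i j i≢j i<n j<n (trans (≡ᵇ⇒≡′ pi≟v) (sym (≡ᵇ⇒≡′ pj≟v))))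
    ... | true  | false = refl
    ... | false | _     = refl

  pair : ∀ i j a b → i ≢ j → i < n → j < n → a < n → b < n →
         ΣL perms (λ P → at P i (suc a) * at P j (suc b)) ≡ offDiag a b * (n ∸ 2) !
  pair i j a b i≢j i<n j<n a<n b<n with <-cmp a b
  ... | tri≈ _ refl _ rewrite ≡ᵇ-refl a = same-value i j (suc a) i≢j i<n j<n
  ... | tri> _ _ b<a rewrite ≢⇒¬≡ᵇ (>⇒≢ b<a) =
    trans (two-point i j (suc a) (suc b) i≢j i<n j<n (s≤s z≤n) (s≤s b<a) a<n) (sym (+-identityʳ _))
  ... | tri< a<b _ _ rewrite ≢⇒¬≡ᵇ (<⇒≢ a<b) =
    trans (ΣL-cong perms (λ P → *-comm (at P i (suc a)) _))
          (trans (two-point j i (suc b) (suc a) (λ j≡i → i≢j (sym j≡i)) j<n i<n (s≤s z≤n) (s≤s a<b) b<n) (sym (+-identityʳ _)))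

  triple : ∀ i j k a b c → i ≢ j → i ≢ k → j ≢ k → i < n → j < n → k < n → a < c → b < c → c < n →
           ΣL perms (λ P → at P i (suc a) * at P j (suc b) * at P k (suc c)) ≡ offDiag a b * (n ∸ 3) !
  triple i j k a b c i≢j i≢k j≢k i<n j<n k<n a<c b<c c<n with <-cmp a b
  ... | tri≈ _ refl _ rewrite ≡ᵇ-refl a =
    ΣL-vanishing perms _ (All.map (λ {P} d → zeroPair P d) (perms-distinct n))
    where
    zeroPair : ∀ P → Distinct n P → at P i (suc a) * at P j (suc a) * at P k (suc c) ≡ 0
    zeroPair P distinct with nth P i ≡ᵇ suc a in pi≟ | nth P j ≡ᵇ suc a in pj≟
    ... | true  | true  = ⊥-elim (distinct i j i≢j i<n j<n (trans (≡ᵇ⇒≡′ pi≟) (sym (≡ᵇ⇒≡′ pj≟))))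
    ... | true  | false = refl
    ... | false | _     = refl
  ... | tri> _ _ b<a rewrite ≢⇒¬≡ᵇ (>⇒≢ b<a) =
    trans (ΣL-cong perms (λ P → trans (rotate (at P i (suc a)) (at P j (suc b)) (at P k (suc c))) (sym (𝟙-satisfies₃ P k (suc c) i (suc a) j (suc b)))))
          (trans (matching-count n ((k , suc c) ∷ (i , suc a) ∷ (j , suc b) ∷ [])
                   ((k<n , s≤s z≤n , c<n) ∷ (i<n , s≤s z≤n , ≤-trans (s≤s (<⇒≤ a<c)) c<n) ∷ (j<n , s≤s z≤n , ≤-trans (s≤s (<⇒≤ b<c)) c<n) ∷ [])
                   ((i≢k ∷ j≢k ∷ []) , ((λ j≡i → i≢j (sym j≡i)) ∷ []) , [] , tt)
                   ((s≤s a<c ∷ s≤s b<c ∷ []) , (s≤s b<a ∷ []) , [] , tt))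
                 (sym (+-identityʳ _)))
    where
    rotate : ∀ x y z → x * y * z ≡ z * x * y
    rotate = solve-∀
  ... | tri< a<b _ _ rewrite ≢⇒¬≡ᵇ (<⇒≢ a<b) =
    trans (ΣL-cong perms (λ P → trans (rotate (at P i (suc a)) (at P j (suc b)) (at P k (suc c))) (sym (𝟙-satisfies₃ P k (suc c) j (suc b) i (suc a)))))
          (trans (matching-count n ((k , suc c) ∷ (j , suc b) ∷ (i , suc a) ∷ [])
                   ((k<n , s≤s z≤n , c<n) ∷ (j<n , s≤s z≤n , ≤-trans (s≤s (<⇒≤ b<c)) c<n) ∷ (i<n , s≤s z≤n , ≤-trans (s≤s (<⇒≤ a<c)) c<n) ∷ [])
                   ((j≢k ∷ i≢k ∷ []) , (i≢j ∷ []) , [] , tt)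
                   ((s≤s b<c ∷ s≤s a<c ∷ []) , (s≤s a<b ∷ []) , [] , tt))
                 (sym (+-identityʳ _)))
    where
    rotate : ∀ x y z → x * y * z ≡ z * y * x
    rotate = solve-∀

  expand : ∀ P → WellFormed n P → ∀ i → i < n → (g : ℕ → ℕ) → g (nth P i) ≡ Σ< n (λ a → at P i (suc a) * g (suc a))
  expand P wf i i<n g with nth P i | nth-All P i (proj₂ wf) (subst (i <_) (sym (proj₁ wf)) i<n)
  ... | zero  | (() , _)
  ... | suc x | (_ , x<n) = sym (Σ<-δ n x (λ a → g (suc a)) x<n)

  expand-under : ∀ P → WellFormed n P → ∀ j → j < n → (c : ℕ) (g : ℕ → ℕ) →
                 c * g (nth P j) ≡ Σ< n (λ b → c * at P j (suc b) * g (suc b))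
  expand-under P wf j j<n c g =
    trans (cong (c *_) (expand P wf j j<n g))
          (trans (sym (Σ<-*ˡ n c _)) (Σ<-cong n (λ b _ → sym (*-assoc c (at P j (suc b)) (g (suc b))))))

  Σ<²-*ˡ : ∀ K (F : ℕ → ℕ → ℕ) → Σ< n (λ a → Σ< n (λ b → K * F a b)) ≡ K * Σ< n (λ a → Σ< n (F a))
  Σ<²-*ˡ K F = trans (Σ<-cong n (λ a _ → Σ<-*ˡ n K (F a))) (Σ<-*ˡ n K _)

  sum-pair : ∀ i j → i ≢ j → i < n → j < n → (F : ℕ → ℕ → ℕ) →
             ΣL perms (λ P → F (nth P i) (nth P j)) ≡ (n ∸ 2) ! * Σ< n (λ a → Σ< n (λ b → offDiag a b * F (suc a) (suc b)))
  sum-pair i j i≢j i<n j<n F = begin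
    ΣL perms (λ P → F (nth P i) (nth P j))
      ≡⟨ ΣL-congᴬ perms (All.map (λ {P} wf → expand₂ P wf) (perms-wellFormed n)) ⟩
    ΣL perms (λ P → Σ< n (λ a → Σ< n (λ b → at P i (suc a) * at P j (suc b) * F (suc a) (suc b))))
      ≡⟨ ΣL-Σ< perms n _ ⟩
    Σ< n (λ a → ΣL perms (λ P → Σ< n (λ b → at P i (suc a) * at P j (suc b) * F (suc a) (suc b))))
      ≡⟨ Σ<-cong n (λ a _ → ΣL-Σ< perms n _) ⟩
    Σ< n (λ a → Σ< n (λ b → ΣL perms (λ P → at P i (suc a) * at P j (suc b) * F (suc a) (suc b))))
      ≡⟨ Σ<-cong n (λ a a<n → Σ<-cong n (λ b b<n → count a b a<n b<n)) ⟩
    Σ< n (λ a → Σ< n (λ b → (n ∸ 2) ! * (offDiag a b * F (suc a) (suc b))))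
      ≡⟨ Σ<²-*ˡ ((n ∸ 2) !) (λ a b → offDiag a b * F (suc a) (suc b)) ⟩
    (n ∸ 2) ! * Σ< n (λ a → Σ< n (λ b → offDiag a b * F (suc a) (suc b))) ∎
    where
    open ≡-Reasoning
    expand₂ : ∀ P → WellFormed n P → F (nth P i) (nth P j) ≡ Σ< n (λ a → Σ< n (λ b → at P i (suc a) * at P j (suc b) * F (suc a) (suc b)))
    expand₂ P wf = trans (expand P wf i i<n (λ u → F u (nth P j)))
                         (Σ<-cong n (λ a _ → expand-under P wf j j<n (at P i (suc a)) (F (suc a))))
    count : ∀ a b → a < n → b < n →
            ΣL perms (λ P → at P i (suc a) * at P j (suc b) * F (suc a) (suc b)) ≡ (n ∸ 2) ! * (offDiag a b * F (suc a) (suc b))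
    count a b a<n b<n = begin
      ΣL perms (λ P → at P i (suc a) * at P j (suc b) * F (suc a) (suc b))
        ≡⟨ ΣL-*ʳ perms _ (F (suc a) (suc b)) ⟩
      ΣL perms (λ P → at P i (suc a) * at P j (suc b)) * F (suc a) (suc b)
        ≡⟨ cong (_* F (suc a) (suc b)) (pair i j a b i≢j i<n j<n a<n b<n) ⟩
      offDiag a b * (n ∸ 2) ! * F (suc a) (suc b)
        ≡⟨ reorder (offDiag a b) ((n ∸ 2) !) (F (suc a) (suc b)) ⟩
      (n ∸ 2) ! * (offDiag a b * F (suc a) (suc b)) ∎
      where
      reorder : ∀ e K f → e * K * f ≡ K * (e * f)
      reorder = solve-∀

  triple-weighted : ∀ i j k → i ≢ j → i ≢ k → j ≢ k → i < n → j < n → k < n → (F : ℕ → ℕ → ℕ → ℕ) →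
                    (∀ a b c → c ≤ a ⊔ b → F (suc a) (suc b) (suc c) ≡ 0) → ∀ a b c → c < n →
                    ΣL perms (λ P → at P i (suc a) * at P j (suc b) * at P k (suc c) * F (suc a) (suc b) (suc c))
                      ≡ (n ∸ 3) ! * (offDiag a b * F (suc a) (suc b) (suc c))
  triple-weighted i j k i≢j i≢k j≢k i<n j<n k<n F vanish a b c c<n with c ≤? a ⊔ b
  ... | yes c≤max rewrite vanish a b c c≤max =
    trans (ΣL-vanishing perms _ (All.universal (λ P → *-zeroʳ (at P i (suc a) * at P j (suc b) * at P k (suc c))) perms))
          (sym (trans (cong ((n ∸ 3) ! *_) (*-zeroʳ (offDiag a b))) (*-zeroʳ ((n ∸ 3) !))))
  ... | no  c≰max = begin
    ΣL perms (λ P → at P i (suc a) * at P j (suc b) * at P k (suc c) * F (suc a) (suc b) (suc c))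
      ≡⟨ ΣL-*ʳ perms _ (F (suc a) (suc b) (suc c)) ⟩
    ΣL perms (λ P → at P i (suc a) * at P j (suc b) * at P k (suc c)) * F (suc a) (suc b) (suc c)
      ≡⟨ cong (_* F (suc a) (suc b) (suc c)) (triple i j k a b c i≢j i≢k j≢k i<n j<n k<n a<c b<c c<n) ⟩
    offDiag a b * (n ∸ 3) ! * F (suc a) (suc b) (suc c)
      ≡⟨ reorder (offDiag a b) ((n ∸ 3) !) _ ⟩
    (n ∸ 3) ! * (offDiag a b * F (suc a) (suc b) (suc c)) ∎
    where
    open ≡-Reasoning
    reorder : ∀ e K f → e * K * f ≡ K * (e * f)
    reorder = solve-∀
    a<c : a < c
    a<c = ≤-<-trans (m≤m⊔n a b) (≰⇒> c≰max)
    b<c : b < c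
    b<c = ≤-<-trans (m≤n⊔m a b) (≰⇒> c≰max)

  sum-triple : ∀ i j k → i ≢ j → i ≢ k → j ≢ k → i < n → j < n → k < n → (F : ℕ → ℕ → ℕ → ℕ) →
               (∀ a b c → c ≤ a ⊔ b → F (suc a) (suc b) (suc c) ≡ 0) →
               ΣL perms (λ P → F (nth P i) (nth P j) (nth P k))
                 ≡ (n ∸ 3) ! * Σ< n (λ a → Σ< n (λ b → Σ< n (λ c → offDiag a b * F (suc a) (suc b) (suc c))))
  sum-triple i j k i≢j i≢k j≢k i<n j<n k<n F vanish = begin
    ΣL perms (λ P → F (nth P i) (nth P j) (nth P k))
      ≡⟨ ΣL-congᴬ perms (All.map (λ {P} wf → expand₃ P wf) (perms-wellFormed n)) ⟩
    ΣL perms (λ P → Σ< n (λ a → Σ< n (λ b → Σ< n (λ c → term P a b c))))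
      ≡⟨ ΣL-Σ< perms n _ ⟩
    Σ< n (λ a → ΣL perms (λ P → Σ< n (λ b → Σ< n (λ c → term P a b c))))
      ≡⟨ Σ<-cong n (λ a _ → trans (ΣL-Σ< perms n _) (Σ<-cong n (λ b _ → ΣL-Σ< perms n _))) ⟩
    Σ< n (λ a → Σ< n (λ b → Σ< n (λ c → ΣL perms (λ P → term P a b c))))
      ≡⟨ Σ<-cong n (λ a _ → Σ<-cong n (λ b _ → Σ<-cong n (λ c c<n → triple-weighted i j k i≢j i≢k j≢k i<n j<n k<n F vanish a b c c<n))) ⟩
    Σ< n (λ a → Σ< n (λ b → Σ< n (λ c → (n ∸ 3) ! * (offDiag a b * F (suc a) (suc b) (suc c)))))
      ≡⟨ trans (Σ<-cong n (λ a _ → Σ<-cong n (λ b _ → Σ<-*ˡ n ((n ∸ 3) !) _))) (Σ<²-*ˡ ((n ∸ 3) !) _) ⟩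
    (n ∸ 3) ! * Σ< n (λ a → Σ< n (λ b → Σ< n (λ c → offDiag a b * F (suc a) (suc b) (suc c)))) ∎
    where
    open ≡-Reasoning
    term : List ℕ → ℕ → ℕ → ℕ → ℕ
    term P a b c = at P i (suc a) * at P j (suc b) * at P k (suc c) * F (suc a) (suc b) (suc c)
    expand₃ : ∀ P → WellFormed n P → F (nth P i) (nth P j) (nth P k) ≡ Σ< n (λ a → Σ< n (λ b → Σ< n (λ c → term P a b c)))
    expand₃ P wf = trans (expand P wf i i<n (λ u → F u (nth P j) (nth P k)))
                     (Σ<-cong n (λ a _ → trans (expand-under P wf j j<n (at P i (suc a)) (λ v → F (suc a) v (nth P k)))
                       (Σ<-cong n (λ b _ → expand-under P wf k k<n (at P i (suc a) * at P j (suc b)) (F (suc a) (suc b))))))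

Σ² : ℕ → (ℕ → ℕ → ℕ) → ℕ
Σ² n F = Σ< n (λ a → Σ< n (F a))

Σ²-suc : ∀ n F → Σ² (suc n) F ≡ Σ² n F + Σ< n (λ a → F a n) + (Σ< n (F n) + F n n)
Σ²-suc n F = cong (_+ (Σ< n (F n) + F n n)) (Σ<-+ n (λ a → Σ< n (F a)) (λ a → F a n))

offDiag-< : ∀ {a n} → a < n → offDiag a n ≡ 1
offDiag-< a<n rewrite ≢⇒¬≡ᵇ (<⇒≢ a<n) = refl

offDiag-> : ∀ {a n} → a < n → offDiag n a ≡ 1
offDiag-> a<n rewrite ≢⇒¬≡ᵇ (>⇒≢ a<n) = refl

offDiag-refl : ∀ n → offDiag n n ≡ 0
offDiag-refl n rewrite ≡ᵇ-refl n = refl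

triangle : ℕ → ℕ
triangle n = Σ< n (λ a → a)

triangle-closed : ∀ n → 2 * triangle n + n ≡ n * n
triangle-closed zero    = refl
triangle-closed (suc n) = trans (expand (triangle n) n) (trans (cong (λ z → z + 2 * n + 1) (triangle-closed n)) (square n))
  where
  expand : ∀ t n → 2 * (t + n) + suc n ≡ 2 * t + n + 2 * n + 1
  expand = solve-∀
  square : ∀ n → n * n + 2 * n + 1 ≡ suc n * suc n
  square = solve-∀

squares : ℕ → ℕ
squares n = Σ< n (λ a → a * a)

squares-closed : ∀ n → 6 * squares n + 3 * (n * n) ≡ 2 * (n * n * n) + n
squares-closed zero    = refl
squares-closed (suc n) = +-cancelʳ-≡ (3 * (n * n)) _ _
  (trans (regroup (squares n) n) (trans (cong (λ z → z + 6 * (n * n) + 3 * (suc n * suc n)) (squares-closed n)) (cube n)))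
  where
  regroup : ∀ s n → 6 * (s + n * n) + 3 * (suc n * suc n) + 3 * (n * n) ≡ 6 * s + 3 * (n * n) + 6 * (n * n) + 3 * (suc n * suc n)
  regroup = solve-∀
  cube : ∀ n → 2 * (n * n * n) + n + 6 * (n * n) + 3 * (suc n * suc n) ≡ 2 * (suc n * suc n * suc n) + suc n + 3 * (n * n)
  cube = solve-∀

pivotSum : ℕ → ℕ
pivotSum n = Σ² n (λ a b → offDiag a b * pivotTerm (suc a) (suc b))

pivotSum≡squares : ∀ n → pivotSum n ≡ squares n
pivotSum≡squares zero    = refl
pivotSum≡squares (suc n) = begin
  pivotSum (suc n)
    ≡⟨ Σ²-suc n _ ⟩
  pivotSum n + Σ< n (λ a → offDiag a n * pivotTerm (suc a) (suc n)) + (Σ< n (λ b → offDiag n b * pivotTerm (suc n) (suc b)) + offDiag n n * pivotTerm (suc n) (suc n))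
    ≡⟨ cong₂ (λ c r → pivotSum n + c + r) column (trans (cong₂ _+_ row (cong (_* pivotTerm (suc n) (suc n)) (offDiag-refl n))) (+-identityʳ _)) ⟩
  pivotSum n + triangle n + (n + triangle n)
    ≡⟨ cong (λ z → z + triangle n + (n + triangle n)) (pivotSum≡squares n) ⟩
  squares n + triangle n + (n + triangle n)
    ≡⟨ trans (regroup (squares n) (triangle n) n) (cong (_+_ (squares n)) (triangle-closed n)) ⟩
  squares n + n * n ∎
  where
  open ≡-Reasoning
  regroup : ∀ s t n → s + t + (n + t) ≡ s + (2 * t + n)
  regroup = solve-∀
  -- a < n = b: no initial swap, min = a
  column : Σ< n (λ a → offDiag a n * pivotTerm (suc a) (suc n)) ≡ triangle n
  column = Σ<-cong n (λ a a<n → begin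
    offDiag a n * (𝟙 (n <ᵇ a) + a ⊓ n)   ≡⟨ cong₂ (λ e s → e * (𝟙 s + a ⊓ n)) (offDiag-< a<n) (≥⇒¬<ᵇ (<⇒≤ a<n)) ⟩
    1 * (0 + a ⊓ n)                      ≡⟨ +-identityʳ _ ⟩
    a ⊓ n                                ≡⟨ m≤n⇒m⊓n≡m (<⇒≤ a<n) ⟩
    a                                    ∎)
  -- b < n = a: the initial swap, min = b
  row : Σ< n (λ b → offDiag n b * pivotTerm (suc n) (suc b)) ≡ n + triangle n
  row = trans (Σ<-cong n (λ b b<n → begin
    offDiag n b * (𝟙 (b <ᵇ n) + n ⊓ b)   ≡⟨ cong₂ (λ e s → e * (𝟙 s + n ⊓ b)) (offDiag-> b<n) (<⇒<ᵇ′ b<n) ⟩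
    1 * (1 + n ⊓ b)                      ≡⟨ +-identityʳ _ ⟩
    1 + n ⊓ b                            ≡⟨ cong suc (m≥n⇒m⊓n≡n (<⇒≤ b<n)) ⟩
    1 + b                                ∎))
    (trans (Σ<-+ n (λ _ → 1) (λ b → b)) (cong (_+ triangle n) (trans (Σ<-const n 1) (*-identityʳ n))))

-- The larger of two distinct values a, b < n equals M in 2M ways.
max-sum : ∀ n (K : ℕ → ℕ) → Σ² n (λ a b → offDiag a b * K (a ⊔ b)) ≡ Σ< n (λ M → 2 * M * K M)
max-sum zero    K = refl
max-sum (suc n) K = begin
  Σ² (suc n) (λ a b → offDiag a b * K (a ⊔ b))
    ≡⟨ Σ²-suc n _ ⟩
  Σ² n (λ a b → offDiag a b * K (a ⊔ b)) + Σ< n (λ a → offDiag a n * K (a ⊔ n)) + (Σ< n (λ b → offDiag n b * K (n ⊔ b)) + offDiag n n * K (n ⊔ n))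
    ≡⟨ cong₂ (λ x y → x + y + (Σ< n (λ b → offDiag n b * K (n ⊔ b)) + offDiag n n * K (n ⊔ n))) (max-sum n K) column ⟩
  Σ< n (λ M → 2 * M * K M) + n * K n + (Σ< n (λ b → offDiag n b * K (n ⊔ b)) + offDiag n n * K (n ⊔ n))
    ≡⟨ cong (_+_ (Σ< n (λ M → 2 * M * K M) + n * K n)) (trans (cong₂ _+_ row (cong (_* K (n ⊔ n)) (offDiag-refl n))) (+-identityʳ _)) ⟩
  Σ< n (λ M → 2 * M * K M) + n * K n + n * K n
    ≡⟨ regroup (Σ< n (λ M → 2 * M * K M)) n (K n) ⟩
  Σ< n (λ M → 2 * M * K M) + 2 * n * K n ∎
  where
  open ≡-Reasoning
  regroup : ∀ s n k → s + n * k + n * k ≡ s + 2 * n * k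
  regroup = solve-∀
  column : Σ< n (λ a → offDiag a n * K (a ⊔ n)) ≡ n * K n
  column = trans (Σ<-cong n (λ a a<n → trans (cong₂ (λ e M → e * K M) (offDiag-< a<n) (m≤n⇒m⊔n≡n (<⇒≤ a<n))) (+-identityʳ (K n))))
                 (Σ<-const n (K n))
  row : Σ< n (λ b → offDiag n b * K (n ⊔ b)) ≡ n * K n
  row = trans (Σ<-cong n (λ b b<n → trans (cong₂ (λ e M → e * K M) (offDiag-> b<n) (m≥n⇒m⊔n≡m (<⇒≤ b<n))) (+-identityʳ (K n))))
              (Σ<-const n (K n))

count-below : ∀ k M → Σ< k (λ j → 𝟙 (j <ᵇ M)) ≡ M ⊓ k
count-below zero    M = sym (⊓-zeroʳ M)
count-below (suc k) M rewrite count-below k M with k <? M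
... | yes k<M rewrite <⇒<ᵇ′ k<M | m≥n⇒m⊓n≡n (<⇒≤ k<M) | m≥n⇒m⊓n≡n k<M = +-comm k 1
... | no  k≮M rewrite ≥⇒¬<ᵇ (≮⇒≥ k≮M) | m≤n⇒m⊓n≡m (≮⇒≥ k≮M) | m≤n⇒m⊓n≡m (≤-trans (≮⇒≥ k≮M) (n≤1+n k)) = +-identityʳ M

count-above : ∀ n M → Σ< n (λ c → 𝟙 (M <ᵇ c)) ≡ n ∸ suc M
count-above zero    M = refl
count-above (suc n) M rewrite count-above n M with M <? n
... | yes M<n rewrite <⇒<ᵇ′ M<n = trans (+-comm (n ∸ suc M) 1) (sym (+-∸-assoc 1 M<n))
... | no  M≮n rewrite ≥⇒¬<ᵇ (≮⇒≥ M≮n) =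
  trans (+-identityʳ _) (trans (m≤n⇒m∸n≡0 (≤-trans (≮⇒≥ M≮n) (n≤1+n M))) (sym (m≤n⇒m∸n≡0 (≮⇒≥ M≮n))))

weighted : ℕ → ℕ
weighted n = Σ< n (λ M → M * M * (n ∸ suc M))

weighted-suc : ∀ n → weighted (suc n) ≡ weighted n + squares n
weighted-suc n = begin
  Σ< n (λ M → M * M * (suc n ∸ suc M)) + n * n * (n ∸ n)
    ≡⟨ cong₂ _+_ (Σ<-cong n oneMore) (trans (cong (n * n *_) (n∸n≡0 n)) (*-zeroʳ (n * n))) ⟩
  Σ< n (λ M → M * M * (n ∸ suc M) + M * M) + 0
    ≡⟨ trans (+-identityʳ _) (Σ<-+ n (λ M → M * M * (n ∸ suc M)) (λ M → M * M)) ⟩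
  weighted n + squares n ∎
  where
  open ≡-Reasoning
  oneMore : ∀ M → M < n → M * M * (suc n ∸ suc M) ≡ M * M * (n ∸ suc M) + M * M
  oneMore M M<n = begin
    M * M * (suc n ∸ suc M)          ≡⟨ cong (M * M *_) (trans (+-∸-assoc 1 M<n) (+-comm 1 (n ∸ suc M))) ⟩
    M * M * (n ∸ suc M + 1)          ≡⟨ *-distribˡ-+ (M * M) (n ∸ suc M) 1 ⟩
    M * M * (n ∸ suc M) + M * M * 1  ≡⟨ cong (_+_ (M * M * (n ∸ suc M))) (*-identityʳ (M * M)) ⟩
    M * M * (n ∸ suc M) + M * M      ∎

weighted-closed : ∀ n → 12 * weighted n + 4 * (n * n * n) + 2 * n ≡ n * n * n * n + 5 * (n * n)
weighted-closed zero    = refl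
weighted-closed (suc n) rewrite weighted-suc n = +-cancelʳ-≡ (4 * (n * n * n) + 2 * n + 6 * (n * n)) _ _
  (trans (regroup (weighted n) (squares n) n)
    (trans (cong₂ (λ x y → x + 2 * y + 4 * (suc n * suc n * suc n) + 2 * suc n) (weighted-closed n) (squares-closed n)) (quartic n)))
  where
  regroup : ∀ g s n → 12 * (g + s) + 4 * (suc n * suc n * suc n) + 2 * suc n + (4 * (n * n * n) + 2 * n + 6 * (n * n))
                    ≡ (12 * g + 4 * (n * n * n) + 2 * n) + 2 * (6 * s + 3 * (n * n)) + 4 * (suc n * suc n * suc n) + 2 * suc n
  regroup = solve-∀
  quartic : ∀ n → (n * n * n * n + 5 * (n * n)) + 2 * (2 * (n * n * n) + n) + 4 * (suc n * suc n * suc n) + 2 * suc n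
                ≡ suc n * suc n * suc n * suc n + 5 * (suc n * suc n) + (4 * (n * n * n) + 2 * n + 6 * (n * n))
  quartic = solve-∀

middleSum : ℕ → ℕ
middleSum m = Σ< (suc m) (λ j → Σ² (3 + m) (λ a b → Σ< (3 + m) (λ c → offDiag a b * middleTerm j (suc a) (suc b) (suc c))))

-- For pivot values a ≠ b with maximum M (values counted from 0), the middle
-- terms count the positions j < min(M, m + 1) and the values c > M.
middleWeight : ℕ → ℕ → ℕ
middleWeight m M = (M ⊓ suc m) * (3 + m ∸ suc M)

middle-pair : ∀ m a b → Σ< (suc m) (λ j → Σ< (3 + m) (λ c → offDiag a b * middleTerm j (suc a) (suc b) (suc c)))
                        ≡ offDiag a b * middleWeight m (a ⊔ b)
middle-pair m a b = begin
  Σ< (suc m) (λ j → Σ< n (λ c → e * (𝟙 (j <ᵇ M) * 𝟙 (M <ᵇ c))))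
    ≡⟨ Σ<-cong (suc m) (λ j _ → trans (Σ<-cong n (λ c _ → sym (*-assoc e _ _))) (Σ<-*ˡ n (e * 𝟙 (j <ᵇ M)) _)) ⟩
  Σ< (suc m) (λ j → e * 𝟙 (j <ᵇ M) * Σ< n (λ c → 𝟙 (M <ᵇ c)))
    ≡⟨ Σ<-*ʳ (suc m) (λ j → e * 𝟙 (j <ᵇ M)) _ ⟩
  Σ< (suc m) (λ j → e * 𝟙 (j <ᵇ M)) * Σ< n (λ c → 𝟙 (M <ᵇ c))
    ≡⟨ cong (_* Σ< n (λ c → 𝟙 (M <ᵇ c))) (Σ<-*ˡ (suc m) e _) ⟩
  e * Σ< (suc m) (λ j → 𝟙 (j <ᵇ M)) * Σ< n (λ c → 𝟙 (M <ᵇ c))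
    ≡⟨ cong₂ (λ x y → e * x * y) (count-below (suc m) M) (count-above n M) ⟩
  e * (M ⊓ suc m) * (n ∸ suc M)
    ≡⟨ *-assoc e _ _ ⟩
  e * middleWeight m M ∎
  where
  open ≡-Reasoning
  n e M : ℕ
  n = 3 + m
  e = offDiag a b
  M = a ⊔ b

-- Below n - 1 the minimum in middleWeight is M; at M = n - 1 no value exceeds M.
middleWeight-max : ∀ m M → M < 3 + m → 2 * M * middleWeight m M ≡ 2 * (M * M * (3 + m ∸ suc M))
middleWeight-max m M M<n with M ≤? suc m
... | yes M≤m+1 rewrite m≤n⇒m⊓n≡m M≤m+1 = regroup M (3 + m ∸ suc M)
  where
  regroup : ∀ M k → 2 * M * (M * k) ≡ 2 * (M * M * k)
  regroup = solve-∀
... | no  M≰m+1 with ≤-antisym (s≤s⁻¹ M<n) (≰⇒> M≰m+1)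
...   | refl rewrite n∸n≡0 (suc (suc m)) = trans (times-zero (2 * M) (M ⊓ suc m)) (sym (times-zero 2 (M * M)))
  where
  times-zero : ∀ a b → a * (b * 0) ≡ 0
  times-zero a b = trans (cong (a *_) (*-zeroʳ b)) (*-zeroʳ a)

middleSum≡ : ∀ m → middleSum m ≡ 2 * weighted (3 + m)
middleSum≡ m = begin
  middleSum m
    ≡⟨ Σ<-swap (suc m) n (λ j a → Σ< n (λ b → X j a b)) ⟩
  Σ< n (λ a → Σ< (suc m) (λ j → Σ< n (λ b → X j a b)))
    ≡⟨ Σ<-cong n (λ a _ → Σ<-swap (suc m) n (λ j b → X j a b)) ⟩
  Σ² n (λ a b → Σ< (suc m) (λ j → X j a b))
    ≡⟨ Σ<-cong n (λ a _ → Σ<-cong n (λ b _ → middle-pair m a b)) ⟩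
  Σ² n (λ a b → offDiag a b * middleWeight m (a ⊔ b))
    ≡⟨ max-sum n (middleWeight m) ⟩
  Σ< n (λ M → 2 * M * middleWeight m M)
    ≡⟨ Σ<-cong n (middleWeight-max m) ⟩
  Σ< n (λ M → 2 * (M * M * (n ∸ suc M)))
    ≡⟨ Σ<-*ˡ n 2 (λ M → M * M * (n ∸ suc M)) ⟩
  2 * weighted n ∎
  where
  open ≡-Reasoning
  n : ℕ
  n = 3 + m
  X : ℕ → ℕ → ℕ → ℕ
  X j a b = Σ< n (λ c → offDiag a b * middleTerm j (suc a) (suc b) (suc c))

total-closed : ∀ m → 6 * (2 * (3 + m) ! + (suc m) ! * squares (3 + m) + m ! * (2 * weighted (3 + m))) ≡ (3 + m) ! * (3 * (3 + m) + 10)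
total-closed m = +-cancelʳ-≡ extra _ _
  (trans (regroup m (m !) (squares n) (weighted n))
    (trans (cong₂ (λ s w → 12 * n ! + suc m * m ! * s + m ! * w) (squares-closed n) (weighted-closed n)) (collect m (m !))))
  where
  n extra : ℕ
  n = 3 + m
  extra = suc m * m ! * (3 * (n * n)) + m ! * (4 * (n * n * n) + 2 * n)
  regroup : ∀ m f s g → 6 * (2 * ((3 + m) * ((2 + m) * ((1 + m) * f))) + (suc m * f) * s + f * (2 * g))
                        + (suc m * f * (3 * ((3 + m) * (3 + m))) + f * (4 * ((3 + m) * (3 + m) * (3 + m)) + 2 * (3 + m)))
                      ≡ 12 * ((3 + m) * ((2 + m) * ((1 + m) * f))) + suc m * f * (6 * s + 3 * ((3 + m) * (3 + m)))
                        + f * (12 * g + 4 * ((3 + m) * (3 + m) * (3 + m)) + 2 * (3 + m))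
  regroup = solve-∀
  collect : ∀ m f → 12 * ((3 + m) * ((2 + m) * ((1 + m) * f))) + suc m * f * (2 * ((3 + m) * (3 + m) * (3 + m)) + (3 + m))
                      + f * ((3 + m) * (3 + m) * (3 + m) * (3 + m) + 5 * ((3 + m) * (3 + m)))
                    ≡ ((3 + m) * ((2 + m) * ((1 + m) * f))) * (3 * (3 + m) + 10)
                      + (suc m * f * (3 * ((3 + m) * (3 + m))) + f * (4 * ((3 + m) * (3 + m) * (3 + m)) + 2 * (3 + m)))
  collect = solve-∀

total-swaps : ∀ m → ΣL (permutations (3 + m)) (firstStepSwaps (3 + m))
                    ≡ 2 * (3 + m) ! + (suc m) ! * pivotSum (3 + m) + m ! * middleSum m
total-swaps m = begin
  ΣL perms (firstStepSwaps n)
    ≡⟨ ΣL-congᴬ perms (All.zipWith (λ (wf , count≤) → Ends.swaps m _ wf count≤) (perms-wellFormed n , perms-count≤ n)) ⟩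
  ΣL perms (λ P → 2 + pivotTerm (x P) (y P) + Σ< (suc m) (λ j → middleTerm j (x P) (y P) (nth P (suc j))))
    ≡⟨ ΣL-+ perms _ _ ⟩
  ΣL perms (λ P → 2 + pivotTerm (x P) (y P)) + ΣL perms (λ P → Σ< (suc m) (λ j → middleTerm j (x P) (y P) (nth P (suc j))))
    ≡⟨ cong₂ _+_ (ΣL-+ perms _ _) (ΣL-Σ< perms (suc m) _) ⟩
  ΣL perms (λ _ → 2) + ΣL perms (λ P → pivotTerm (x P) (y P)) + Σ< (suc m) (λ j → ΣL perms (λ P → middleTerm j (x P) (y P) (nth P (suc j))))
    ≡⟨ cong₂ (λ a b → a + b + Σ< (suc m) (λ j → ΣL perms (λ P → middleTerm j (x P) (y P) (nth P (suc j))))) twice (sum-pair 0 (2 + m) (λ ()) (s≤s z≤n) ≤-refl pivotTerm) ⟩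
  2 * n ! + (suc m) ! * pivotSum n + Σ< (suc m) (λ j → ΣL perms (λ P → middleTerm j (x P) (y P) (nth P (suc j))))
    ≡⟨ cong (λ z → 2 * n ! + (suc m) ! * pivotSum n + z) (trans (Σ<-cong (suc m) middle) (Σ<-*ˡ (suc m) (m !) _)) ⟩
  2 * n ! + (suc m) ! * pivotSum n + m ! * middleSum m ∎
  where
  open ≡-Reasoning
  open Marginals (3 + m)
  n : ℕ
  n = 3 + m
  x y : List ℕ → ℕ
  x P = nth P 0
  y P = nth P (2 + m)
  twice : ΣL perms (λ _ → 2) ≡ 2 * n !
  twice = trans (ΣL-*ˡ perms 2 (λ _ → 1)) (cong (2 *_) (matching-count n [] [] tt tt))
  middle : ∀ j → j < suc m → ΣL perms (λ P → middleTerm j (x P) (y P) (nth P (suc j)))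
                               ≡ m ! * Σ² n (λ a b → Σ< n (λ c → offDiag a b * middleTerm j (suc a) (suc b) (suc c)))
  middle j j<1+m = sum-triple 0 (2 + m) (suc j) (λ ()) (λ ()) (λ 2+m≡1+j → <-irrefl (sym 2+m≡1+j) (s≤s j<1+m))
                     (s≤s z≤n) ≤-refl (s≤s (m≤n⇒m≤1+n j<1+m)) (middleTerm j) vanish
    where
    vanish : ∀ a b c → c ≤ a ⊔ b → middleTerm j (suc a) (suc b) (suc c) ≡ 0
    vanish a b c c≤max = trans (cong (λ z → 𝟙 (j <ᵇ a ⊔ b) * 𝟙 z) (≥⇒¬<ᵇ c≤max)) (*-zeroʳ (𝟙 (j <ᵇ a ⊔ b)))

-- t / N = (n + 1)/2 + 7/6 as soon as 6 t = N (3n + 10); checked by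
-- cross-multiplication in the unnormalised rationals.
mean-value : ∀ n t N .{{_ : NonZero N}} → 6 * t ≡ N * (3 * n + 10) → (+ t) / N ≡ (+ (n + 1)) / 2 +ℚ (+ 7) / 6
mean-value n t N eq = trans (ℚ./-cong {+ t} {N} {+ t} {suc d} refl (sym (suc-pred N))) (ℚ.toℚᵘ-injective unnormalised)
  where
  d : ℕ
  d = pred N
  crossℕ : t * 12 ≡ ((n + 1) * 6 + 7 * 2) * suc d
  crossℕ = trans (double t) (trans (cong (2 *_) (trans eq (cong (_* (3 * n + 10)) (sym (suc-pred N))))) (expand n (suc d)))
    where
    double : ∀ t → t * 12 ≡ 2 * (6 * t)
    double = solve-∀
    expand : ∀ n s → 2 * (s * (3 * n + 10)) ≡ ((n + 1) * 6 + 7 * 2) * s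
    expand = solve-∀
  crossℤ : + t ℤ.* + 12 ≡ (+ (n + 1) ℤ.* + 6 ℤ.+ + 7 ℤ.* + 2) ℤ.* + suc d
  crossℤ = begin
    + t ℤ.* + 12                                      ≡⟨ ℤ.pos-* t 12 ⟨
    + (t * 12)                                        ≡⟨ cong +_ crossℕ ⟩
    + (((n + 1) * 6 + 7 * 2) * suc d)                 ≡⟨ ℤ.pos-* ((n + 1) * 6 + 7 * 2) (suc d) ⟩
    + ((n + 1) * 6 + 7 * 2) ℤ.* + suc d               ≡⟨ cong (ℤ._* + suc d) (ℤ.pos-+ ((n + 1) * 6) (7 * 2)) ⟩
    (+ ((n + 1) * 6) ℤ.+ + (7 * 2)) ℤ.* + suc d        ≡⟨ cong (ℤ._* + suc d) (cong₂ ℤ._+_ (ℤ.pos-* (n + 1) 6) (ℤ.pos-* 7 2)) ⟩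
    (+ (n + 1) ℤ.* + 6 ℤ.+ + 7 ℤ.* + 2) ℤ.* + suc d   ∎
    where open ≡-Reasoning
  unnormalised : toℚᵘ ((+ t) / suc d) ℚᵘ.≃ toℚᵘ ((+ (n + 1)) / 2 +ℚ (+ 7) / 6)
  unnormalised =
    ℚᵘ.≃-trans (ℚ.toℚᵘ-fromℚᵘ (mkℚᵘ (+ t) d))
      (ℚᵘ.≃-trans (*≡* crossℤ)
        (ℚᵘ.≃-sym (ℚᵘ.≃-trans (ℚ.toℚᵘ-homo-+ ((+ (n + 1)) / 2) ((+ 7) / 6))
                     (ℚᵘ.+-cong (ℚ.toℚᵘ-fromℚᵘ (mkℚᵘ (+ (n + 1)) 1)) (ℚ.toℚᵘ-fromℚᵘ (mkℚᵘ (+ 7) 5))))))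

mainTheorem6 : ∀ (n : ℕ) → n ≥ 3 →
    expectedSwaps n ≡ ((+ (n + 1)) / 2) +ℚ ((+ 7) / 6)
mainTheorem6 (suc (suc (suc m))) (s≤s (s≤s (s≤s _))) = mean-value n (sum (map (firstStepSwaps n) (permutations n))) (n !) {{n !≢0}} (begin
  6 * sum (map (firstStepSwaps n) (permutations n))
    ≡⟨ cong (6 *_) (trans (sum-map≡ΣL (permutations n) (firstStepSwaps n)) (total-swaps m)) ⟩
  6 * (2 * n ! + (suc m) ! * pivotSum n + m ! * middleSum m)
    ≡⟨ cong₂ (λ s w → 6 * (2 * n ! + (suc m) ! * s + m ! * w)) (pivotSum≡squares n) (middleSum≡ m) ⟩
  6 * (2 * n ! + (suc m) ! * squares n + m ! * (2 * weighted n))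
    ≡⟨ total-closed m ⟩
  n ! * (3 * n + 10) ∎)
  where
  open ≡-Reasoning
  n : ℕ
  n = 3 + m
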